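{- Let $\mathcal{P}$ and $\tilde{\mathcal{P}}$ be two distinct balanced $k$-partitions of $G$ such that the subgraph induced by each part of each partition has a unique spanning tree. Then the following are equivalent: (1) $\mathcal{P}$ and $\tilde{\mathcal{P}}$ differ by a set of disjoint BUD steps on partitions. (2) The number of parts of $\mathcal{P}$ that are not parts of $\tilde{\mathcal{P}}$ equals the number of edges in $\mathcal{P}$ that are not in $\tilde{\mathcal{P}}$, where an edge is said to be in a partition if it belongs to the (unique) spanning tree of one of its parts.
   Context: $G$ is a connected graph with vertex populations $p:V(G)\to\mathbb{R}^+$; $k\ge2$. A balanced $k$-partition of $G$ is a partition of $V(G)$ into $k$ parts, each inducing a connected subgraph, all of equal population. $G/\mathcal{P}$ is the quotient multigraph obtained by contracting each part of $\mathcal{P}$, keeping multiple edges. A BUD step on partitions applied to a cycle $P_1\to\cdots\to P_\ell\to P_1$ of parts in $G/\mathcal{P}$ consists of choosing vertex sets $H_i\subseteq P_i$ with $H_i$ and $P_i\setminus H_i$ each inducing connected subgraphs, and transferring $H_i$ from $P_i$ to $P_{i+1}$ for all $i\in[\ell]$ (indices cyclic). $\mathcal{P}$ and $\tilde{\mathcal{P}}$ differ by a set of disjoint BUD steps on partitions if there are cycles in $G/\mathcal{P}$ using pairwise disjoint sets of parts, with such choices of sets $H_i$, such that performing all these transfers simultaneously turns $\mathcal{P}$ into $\tilde{\mathcal{P}}$.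
   Formalization: The vertex populations p take values in the positive rationals instead of the positive reals. -}

module Defs where

open import Data.Bool using (Bool; true; false; _∧_; not; if_then_else_)
open import Data.Nat using (ℕ; zero; suc; _+_; _≤_; _<_; _<?_)
open import Data.Fin using (Fin; zero; suc; toℕ; _≟_)
open import Data.List using (List; map; foldr; allFin)
open import Data.Bool.ListAction using (any; all)
open import Data.Product using (Σ; ∃; _×_; _,_)
open import Data.Sum using (_⊎_)
open import Data.Rational using (ℚ; 0ℚ) renaming (_+_ to _+ℚ_; _<_ to _<ℚ_)
open import Relation.Nullary using (¬_)
open import Relation.Nullary.Decidable using (⌊_⌋)
open import Relation.Binary.PropositionalEquality using (_≡_; _≢_)
open import Function.Bundles using (_⇔_)

record Graph : Set where
  field
    n         : ℕ
    adj       : Fin n → Fin n → Bool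
    adj-sym   : ∀ u v → adj u v ≡ adj v u
    adj-irrefl : ∀ v → adj v v ≡ false

open Graph public

VSet : ℕ → Set
VSet n = Fin n → Bool

-- edge sets: Bool-valued symmetric relations (an edge {u,v} is present iff E u v ≡ true)
ESet : ℕ → Set
ESet n = Fin n → Fin n → Bool

data Walk {n : ℕ} (E : ESet n) (S : VSet n) : Fin n → Fin n → Set where
  here : ∀ {u} → Walk E S u u
  step : ∀ {u w v} → E u w ≡ true → S w ≡ true → Walk E S w v → Walk E S u v

InducesConnected : (G : Graph) → VSet (n G) → Set
InducesConnected G S =
  (∃ λ v → S v ≡ true) ×
  (∀ u v → S u ≡ true → S v ≡ true → Walk (adj G) S u v)

ConnectedGraph : Graph → Set
ConnectedGraph G = InducesConnected G (λ _ → true)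

countℕ : ∀ {m} → (Fin m → Bool) → ℕ
countℕ {m} f = foldr _+_ 0 (map (λ i → if f i then 1 else 0) (allFin m))

anyFin : ∀ {m} → (Fin m → Bool) → Bool
anyFin {m} f = any f (allFin m)

allFin? : ∀ {m} → (Fin m → Bool) → Bool
allFin? {m} f = all f (allFin m)

_==_ : ∀ {m} → Fin m → Fin m → Bool
i == j = ⌊ i ≟ j ⌋

sumFin : ∀ {m} → (Fin m → ℕ) → ℕ
sumFin {m} f = foldr _+_ 0 (map f (allFin m))

countEdges : ∀ {n} → ESet n → ℕ
countEdges {n} E = sumFin {n} (λ u → countℕ {n} (λ v → ⌊ toℕ u <? toℕ v ⌋ ∧ E u v))

size : ∀ {n} → VSet n → ℕ
size S = countℕ S

popSum : ∀ {n} → (Fin n → ℚ) → VSet n → ℚ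
popSum {n} p S = foldr _+ℚ_ 0ℚ (map (λ v → if S v then p v else 0ℚ) (allFin n))

IsSpanningTree : (G : Graph) → VSet (n G) → ESet (n G) → Set
IsSpanningTree G S T =
  (∀ u v → T u v ≡ T v u) ×
  (∀ u v → T u v ≡ true → (adj G u v ≡ true) × (S u ≡ true) × (S v ≡ true)) ×
  (∀ u v → S u ≡ true → S v ≡ true → Walk T S u v) ×
  (countEdges T + 1 ≡ size S)

IsUniqueSpanningTree : (G : Graph) → VSet (n G) → ESet (n G) → Set
IsUniqueSpanningTree G S T =
  IsSpanningTree G S T ×
  (∀ T' → IsSpanningTree G S T' → ∀ u v → T' u v ≡ T u v)

part : ∀ {n k} → (Fin n → Fin k) → Fin k → VSet n
part P i v = P v == i

record BalancedPartition (G : Graph) (p : Fin (n G) → ℚ) (k : ℕ) : Set where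
  field
    label     : Fin (n G) → Fin k
    connected : ∀ i → InducesConnected G (part label i)   -- includes nonemptiness
    balanced  : ∀ i j → popSum p (part label i) ≡ popSum p (part label j)

open BalancedPartition public

SamePartition : ∀ {n k} → (Fin n → Fin k) → (Fin n → Fin k) → Set
SamePartition P Q = ∀ u v → (P u ≡ P v) ⇔ (Q u ≡ Q v)

isPartOf : ∀ {n k} → (Fin n → Fin k) → Fin k → (Fin n → Fin k) → Bool
isPartOf P i Q = anyFin (λ j → allFin? (λ v → boolEq (P v == i) (Q v == j)))
  where
  boolEq : Bool → Bool → Bool
  boolEq true b = b
  boolEq false b = not b

partsNotIn : ∀ {n k} → (Fin n → Fin k) → (Fin n → Fin k) → ℕ
partsNotIn P Q = countℕ (λ i → not (isPartOf P i Q))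

edgeIn : ∀ {n k} → (Fin k → ESet n) → Fin n → Fin n → Bool
edgeIn T u v = anyFin (λ i → T i u v)

edgesNotIn : (G : Graph) → ∀ {k} → (Fin k → ESet (n G)) → (Fin k → ESet (n G)) → ℕ
edgesNotIn G T T̃ = countEdges (λ u v → adj G u v ∧ edgeIn T u v ∧ not (edgeIn T̃ u v))

-- cyclic successor on Fin (suc m): j ↦ j+1, last ↦ 0
cnext : ∀ {m} → Fin (suc m) → Fin (suc m)
cnext {zero} zero = zero
cnext {suc m} zero = suc zero
cnext {suc m} (suc j) with cnext {m} j
... | zero  = zero
... | suc r = suc (suc r)

-- a cycle P_{c 0} → P_{c 1} → ... → P_{c (ℓ-1)} → P_{c 0} in G/P, ℓ = 2 + len₋₂,
-- with pairwise distinct parts; step j uses the edge {eu j, ev j} of G,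
-- and distinct steps use distinct edges (relevant for ℓ = 2: parallel edges)
record QCycle (G : Graph) {k : ℕ} (P : Fin (n G) → Fin k) : Set where
  field
    len₋₂   : ℕ
    cpart   : Fin (2 + len₋₂) → Fin k
    cpart-inj : ∀ a b → cpart a ≡ cpart b → a ≡ b
    eu ev   : Fin (2 + len₋₂) → Fin (n G)
    e-adj   : ∀ j → adj G (eu j) (ev j) ≡ true
    e-from  : ∀ j → P (eu j) ≡ cpart j
    e-to    : ∀ j → P (ev j) ≡ cpart (cnext j)
    e-dist  : ∀ j j' → j ≢ j' →
              ¬ (((eu j ≡ eu j') × (ev j ≡ ev j')) ⊎ ((eu j ≡ ev j') × (ev j ≡ eu j')))

open QCycle public

record BUDChoice (G : Graph) {k : ℕ} (P : Fin (n G) → Fin k) (C : QCycle G P) : Set where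
  field
    H      : Fin (2 + len₋₂ C) → VSet (n G)
    H-sub  : ∀ j v → H j v ≡ true → P v ≡ cpart C j
    H-conn : ∀ j → InducesConnected G (H j)
    R-conn : ∀ j → InducesConnected G (λ v → part P (cpart C j) v ∧ not (H j v))

open BUDChoice public

DifferByDisjointBUD : (G : Graph) → ∀ {k} → (Fin (n G) → Fin k) → (Fin (n G) → Fin k) → Set
DifferByDisjointBUD G {k} P P̃ =
  Σ ℕ λ r →
  Σ (Fin r → QCycle G P) λ C →
  Σ ((a : Fin r) → BUDChoice G P (C a)) λ B →
    (∀ a b (ja : Fin (2 + len₋₂ (C a))) (jb : Fin (2 + len₋₂ (C b))) →
       a ≢ b → cpart (C a) ja ≢ cpart (C b) jb) ×
    -- Q is the result of performing all transfers simultaneously, and Q = P̃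
    (Σ (Fin (n G) → Fin k) λ Q →
      (∀ v →
        (∀ a j → P v ≡ cpart (C a) j → H (B a) j v ≡ true → Q v ≡ cpart (C a) (cnext j)) ×
        ((∀ a j → ¬ ((P v ≡ cpart (C a) j) × (H (B a) j v ≡ true))) → Q v ≡ P v)) ×
      SamePartition Q P̃)

-- A unique spanning tree of G[S] contains every edge of G[S], so an edge of P is lost in P̃ exactly
-- when its ends lie in one part of P but in different parts of P̃. Since populations are positive and
-- all parts have the same population, a part of P that is not a part of P̃ meets at least two parts
-- of P̃ and, its subgraph being connected, loses at least one edge; an unchanged part loses none.
-- Hence (2) holds iff every changed part is cut along exactly one tree edge, i.e. into two connected
-- pieces. A BUD step splits each part of its cycle into the moved and the remaining set, both
-- connected, which gives (1) ⇒ (2). Conversely, if every changed part is cut into two pieces, double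
-- counting the incidences between old and new parts shows that every new part meeting a changed part
-- meets exactly two old parts. The changed parts then form disjoint cycles, and moving along each
-- cycle one piece of every part into the next part produces P̃.

module Submission where

open import Algebra.Bundles using (CommutativeMonoid)
open import Data.Bool using (Bool; true; false; _∧_; _∨_; _xor_; not; if_then_else_)
open import Data.Bool.Properties using (∧-comm; ∨-comm; ∧-distribˡ-∨; ∧-zeroʳ; ∨-zeroʳ; not-involutive; T-≡; ¬-not)
open import Data.Empty using (⊥; ⊥-elim)
open import Data.Fin using (Fin; zero; suc; toℕ; _≟_)
import Data.Fin.Properties as Finₚ
open import Data.List using (map; foldr; allFin)
open import Data.List.Properties using (map-tabulate)
import Data.List.Relation.Unary.All.Properties as Allₚ
import Data.List.Relation.Unary.Any.Properties as Anyₚ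
open import Data.Nat using (ℕ; zero; suc; _+_; _≤_; _<_; z≤n; s≤s; _<?_)
open import Data.Nat.Properties as ℕₚ
  using (≤-refl; ≤-trans; <-irrefl; <-≤-trans; +-mono-≤; +-mono-<-≤; +-mono-≤-<; <-cmp)
open import Data.Product using (∃; ∃₂; _×_; _,_; proj₁; proj₂)
open import Data.Rational using (ℚ; 0ℚ) renaming (_≤_ to _≤ℚ_; _<_ to _<ℚ_)
import Data.Rational.Properties as ℚₚ
open import Data.Sum using (_⊎_; inj₁; inj₂)
import Data.Vec.Functional as Vector
open import Function using (_∘_; id; _⇔_; mk⇔; Equivalence)
open import Level using (0ℓ)
open import Relation.Binary.Definitions using (tri<; tri≈; tri>)
open import Relation.Binary.PropositionalEquality
  using (_≡_; _≢_; refl; sym; trans; cong; cong₂; subst; subst₂; module ≡-Reasoning)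
open import Relation.Nullary using (¬_; yes; no)
open import Relation.Nullary.Decidable using (⌊_⌋; toSum)

open import Defs

foldr-map-allFin : ∀ {A : Set} (_∙_ : A → A → A) (e : A) {m} (f : Fin m → A) →
  foldr _∙_ e (map f (allFin m)) ≡ Vector.foldr _∙_ e f
foldr-map-allFin _∙_ e {zero} f = refl
foldr-map-allFin _∙_ e {suc m} f = cong (f zero ∙_) (begin
  foldr _∙_ e (map f (Data.List.tabulate suc))    ≡⟨ cong (foldr _∙_ e) (map-tabulate suc f) ⟩
  foldr _∙_ e (Data.List.tabulate (f ∘ suc))      ≡⟨ cong (foldr _∙_ e) (sym (map-tabulate id (f ∘ suc))) ⟩
  foldr _∙_ e (map (f ∘ suc) (allFin m))          ≡⟨ foldr-map-allFin _∙_ e (f ∘ suc) ⟩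
  Vector.foldr _∙_ e (f ∘ suc)                    ∎)
  where open ≡-Reasoning

true≢false : true ≢ false
true≢false ()

∧-elimˡ : ∀ {a b} → a ∧ b ≡ true → a ≡ true
∧-elimˡ {true} _ = refl

∧-elimʳ : ∀ {a b} → a ∧ b ≡ true → b ≡ true
∧-elimʳ {true} h = h

∧-intro : ∀ {a b} → a ≡ true → b ≡ true → a ∧ b ≡ true
∧-intro refl refl = refl

∨-introˡ : ∀ {a} b → a ≡ true → a ∨ b ≡ true
∨-introˡ _ refl = refl

∨-introʳ : ∀ a {b} → b ≡ true → a ∨ b ≡ true
∨-introʳ a refl = ∨-zeroʳ a

∨-elim : ∀ {a b} → a ∨ b ≡ true → a ≡ true ⊎ b ≡ true
∨-elim {true} _ = inj₁ refl
∨-elim {false} h = inj₂ h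

not-true : {a : Bool} → not a ≡ true → a ≡ false
not-true {false} _ = refl

not-intro : {a : Bool} → a ≡ false → not a ≡ true
not-intro refl = refl

not-false : {a : Bool} → not a ≡ false → a ≡ true
not-false {true} _ = refl

∧-disjointʳ : ∀ a {b c} → b ∧ c ≡ false → (a ∧ b) ∧ (a ∧ c) ≡ false
∧-disjointʳ false _ = refl
∧-disjointʳ true b∧c = b∧c

∧-monoʳ : ∀ a {b c} → (b ≡ true → c ≡ true) → a ∧ b ≡ true → a ∧ c ≡ true
∧-monoʳ true b⇒c = b⇒c

module _ {m : ℕ} where

  ==-refl : (i : Fin m) → (i == i) ≡ true
  ==-refl i with i ≟ i
  ... | yes _ = refl
  ... | no i≢i = ⊥-elim (i≢i refl)

  ==⇒≡ : {i j : Fin m} → (i == j) ≡ true → i ≡ j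
  ==⇒≡ {i} {j} h with i ≟ j
  ... | yes i≡j = i≡j

  ≡⇒== : {i j : Fin m} → i ≡ j → (i == j) ≡ true
  ≡⇒== {i} refl = ==-refl i

  ≢⇒==-false : {i j : Fin m} → i ≢ j → (i == j) ≡ false
  ≢⇒==-false {i} {j} i≢j with i ≟ j
  ... | yes i≡j = ⊥-elim (i≢j i≡j)
  ... | no _ = refl

  ==-false⇒≢ : {i j : Fin m} → (i == j) ≡ false → i ≢ j
  ==-false⇒≢ h refl = true≢false (trans (sym (==-refl _)) h)

  ==-sym : (i j : Fin m) → (i == j) ≡ (j == i)
  ==-sym i j with i ≟ j | j ≟ i
  ... | yes _ | yes _ = refl
  ... | no _ | no _ = refl
  ... | yes i≡j | no j≢i = ⊥-elim (j≢i (sym i≡j))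
  ... | no i≢j | yes j≡i = ⊥-elim (i≢j (sym j≡i))

module FinSum (M : CommutativeMonoid 0ℓ 0ℓ) where
  open CommutativeMonoid M using (Carrier; _≈_; _∙_; ε; setoid; ∙-congˡ; identityʳ)
    renaming (refl to ≈-refl; sym to ≈-sym; trans to ≈-trans)
  open import Algebra.Properties.CommutativeMonoid.Sum M public
  open import Relation.Binary.Reasoning.Setoid setoid

  sum-zero : ∀ {m} (f : Fin m → Carrier) → (∀ i → f i ≈ ε) → sum f ≈ ε
  sum-zero {m} f f≈0 = ≈-trans (sum-cong-≋ f≈0) (sum-replicate-zero m)

  sum-single : ∀ {m} (f : Fin m → Carrier) (j : Fin m) → (∀ i → i ≢ j → f i ≈ ε) → sum f ≈ f j
  sum-single {suc m} f j f≈0 = begin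
    sum f                                ≈⟨ sum-remove f ⟩
    f j ∙ sum (Vector.removeAt f j)      ≈⟨ ∙-congˡ (sum-zero _ (λ i → f≈0 _ (Finₚ.punchInᵢ≢i j i))) ⟩
    f j ∙ ε                              ≈⟨ identityʳ (f j) ⟩
    f j                                  ∎

  sum-byLabel : ∀ {m k} (L : Fin m → Fin k) (f : Fin m → Carrier) →
    sum f ≈ ∑[ i < k ] ∑[ u < m ] (if L u == i then f u else ε)
  sum-byLabel {m} {k} L f = begin
    sum f
      ≈⟨ sum-cong-≋ (λ u → ≈-sym (≈-trans (sum-single _ (L u) (off u)) (at u))) ⟩
    ∑[ u < m ] ∑[ i < k ] (if L u == i then f u else ε)
      ≈⟨ ∑-comm (λ u i → if L u == i then f u else ε) ⟩
    ∑[ i < k ] ∑[ u < m ] (if L u == i then f u else ε) ∎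
    where
    off : ∀ u i → i ≢ L u → (if L u == i then f u else ε) ≈ ε
    off u i i≢Lu with L u ≟ i
    ... | yes Lu≡i = ⊥-elim (i≢Lu (sym Lu≡i))
    ... | no _ = ≈-refl
    at : ∀ u → (if L u == L u then f u else ε) ≈ f u
    at u rewrite ==-refl (L u) = ≈-refl

module ℚSum where
  open FinSum ℚₚ.+-0-commutativeMonoid public

  sum-mono-≤ : ∀ {m} {f g : Fin m → ℚ} → (∀ i → f i ≤ℚ g i) → sum f ≤ℚ sum g
  sum-mono-≤ {zero} f≤g = ℚₚ.≤-refl
  sum-mono-≤ {suc m} f≤g = ℚₚ.+-mono-≤ (f≤g zero) (sum-mono-≤ (f≤g ∘ suc))

  sum-mono-< : ∀ {m} {f g : Fin m → ℚ} → (∀ i → f i ≤ℚ g i) → ∀ j → f j <ℚ g j → sum f <ℚ sum g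
  sum-mono-< {suc m} f≤g zero fj<gj = ℚₚ.+-mono-<-≤ fj<gj (sum-mono-≤ (f≤g ∘ suc))
  sum-mono-< {suc m} f≤g (suc j) fj<gj = ℚₚ.+-mono-≤-< (f≤g zero) (sum-mono-< (f≤g ∘ suc) j fj<gj)

open FinSum ℕₚ.+-0-commutativeMonoid

sum-mono-≤ : ∀ {m} {f g : Fin m → ℕ} → (∀ i → f i ≤ g i) → sum f ≤ sum g
sum-mono-≤ {zero} f≤g = z≤n
sum-mono-≤ {suc m} f≤g = +-mono-≤ (f≤g zero) (sum-mono-≤ (f≤g ∘ suc))

sum-mono-< : ∀ {m} {f g : Fin m → ℕ} → (∀ i → f i ≤ g i) → ∀ j → f j < g j → sum f < sum g
sum-mono-< {suc m} f≤g zero fj<gj = +-mono-<-≤ fj<gj (sum-mono-≤ (f≤g ∘ suc))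
sum-mono-< {suc m} f≤g (suc j) fj<gj = +-mono-≤-< (f≤g zero) (sum-mono-< (f≤g ∘ suc) j fj<gj)

sum-mono-≤-equality : ∀ {m} {f g : Fin m → ℕ} → (∀ i → f i ≤ g i) → sum f ≡ sum g → ∀ i → f i ≡ g i
sum-mono-≤-equality {f = f} {g} f≤g Σf≡Σg i with <-cmp (f i) (g i)
... | tri≈ _ fi≡gi _ = fi≡gi
... | tri< fi<gi _ _ = ⊥-elim (<-irrefl Σf≡Σg (sum-mono-< f≤g i fi<gi))
... | tri> _ _ fi>gi = ⊥-elim (<-irrefl refl (<-≤-trans fi>gi (f≤g i)))

search : ∀ {m} (f : Fin m → Bool) → (∃ λ i → f i ≡ true) ⊎ (∀ i → f i ≡ false)
search f with Finₚ.any? (λ i → f i Data.Bool.≟ true)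
... | yes found = inj₁ found
... | no none = inj₂ (λ i → ¬-not (λ fi → none (i , fi)))

module _ {m : ℕ} (f : Fin m → Bool) where

  anyFin⇒∃ : anyFin f ≡ true → ∃ λ i → f i ≡ true
  anyFin⇒∃ h with Anyₚ.tabulate⁻ (Anyₚ.any⁻ f (allFin m) (Equivalence.from T-≡ h))
  ... | i , fi = i , Equivalence.to T-≡ fi

  ∃⇒anyFin : ∀ i → f i ≡ true → anyFin f ≡ true
  ∃⇒anyFin i fi = Equivalence.to T-≡ (Anyₚ.any⁺ f (Anyₚ.tabulate⁺ i (Equivalence.from T-≡ fi)))

  anyFin-false : anyFin f ≡ false → ∀ i → f i ≡ false
  anyFin-false h i = ¬-not (λ fi → true≢false (trans (sym (∃⇒anyFin i fi)) h))

  allFin?⇒∀ : allFin? f ≡ true → ∀ i → f i ≡ true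
  allFin?⇒∀ h i = Equivalence.to T-≡ (Allₚ.tabulate⁻ (Allₚ.all⁺ f (allFin m) (Equivalence.from T-≡ h)) i)

  ∀⇒allFin? : (∀ i → f i ≡ true) → allFin? f ≡ true
  ∀⇒allFin? fs = Equivalence.to T-≡ (Allₚ.all⁻ f (Allₚ.tabulate⁺ (Equivalence.from T-≡ ∘ fs)))

  allFin?-false : allFin? f ≡ false → ∃ λ i → f i ≡ false
  allFin?-false h with search (not ∘ f)
  ... | inj₁ (i , ¬fi) = i , not-true ¬fi
  ... | inj₂ none = ⊥-elim (true≢false (trans (sym (∀⇒allFin? (λ i → not-false (none i)))) h))

indicator : Bool → ℕ
indicator b = if b then 1 else 0

count : ∀ {m} → (Fin m → Bool) → ℕ
count f = sum (indicator ∘ f)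

countℕ≡count : ∀ {m} (f : Fin m → Bool) → countℕ f ≡ count f
countℕ≡count f = foldr-map-allFin _+_ 0 (indicator ∘ f)

indicator-mono : ∀ {a b} → (a ≡ true → b ≡ true) → indicator a ≤ indicator b
indicator-mono {false} _ = z≤n
indicator-mono {true} a⇒b rewrite a⇒b refl = ≤-refl

module _ {m : ℕ} where

  count-cong : {f g : Fin m → Bool} → (∀ i → f i ≡ g i) → count f ≡ count g
  count-cong f≡g = sum-cong-≗ (cong indicator ∘ f≡g)

  count-mono : {f g : Fin m → Bool} → (∀ i → f i ≡ true → g i ≡ true) → count f ≤ count g
  count-mono f⊆g = sum-mono-≤ (λ i → indicator-mono (f⊆g i))

  count-mono-< : {f g : Fin m → Bool} → (∀ i → f i ≡ true → g i ≡ true) →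
    ∀ j → f j ≡ false → g j ≡ true → count f < count g
  count-mono-< {f} {g} f⊆g j fj gj =
    sum-mono-< (λ i → indicator-mono (f⊆g i)) j (subst₂ (λ a b → indicator a < indicator b) (sym fj) (sym gj) ≤-refl)

  count-none : (f : Fin m → Bool) → (∀ i → f i ≡ false) → count f ≡ 0
  count-none f none = sum-zero _ (cong indicator ∘ none)

  count-∨ : (f g : Fin m → Bool) → (∀ i → f i ∧ g i ≡ false) →
    count (λ i → f i ∨ g i) ≡ count f + count g
  count-∨ f g disjoint =
    trans (sum-cong-≗ (λ i → indicator-∨ (f i) (g i) (disjoint i))) (∑-distrib-+ (indicator ∘ f) (indicator ∘ g))
    where
    indicator-∨ : ∀ a b → a ∧ b ≡ false → indicator (a ∨ b) ≡ indicator a + indicator b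
    indicator-∨ false b _ = refl
    indicator-∨ true false _ = refl

  count-single : (j : Fin m) → count (_== j) ≡ 1
  count-single j = trans (sum-single _ j (λ i i≢j → cong indicator (≢⇒==-false i≢j))) (cong indicator (==-refl j))

  count-insert : (j : Fin m) (g : Fin m → Bool) → g j ≡ false → count (λ i → (i == j) ∨ g i) ≡ suc (count g)
  count-insert j g gj = trans (count-∨ (_== j) g disjoint) (cong (_+ count g) (count-single j))
    where
    disjoint : ∀ i → (i == j) ∧ g i ≡ false
    disjoint i with i ≟ j
    ... | yes refl = gj
    ... | no _ = refl

  ∃⇒count-pos : (f : Fin m → Bool) → ∀ j → f j ≡ true → 1 ≤ count f
  ∃⇒count-pos f j fj = begin
    1                 ≡⟨ count-single j ⟨
    count (_== j)     ≤⟨ count-mono (λ i i==j → subst (λ x → f x ≡ true) (sym (==⇒≡ i==j)) fj) ⟩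
    count f           ∎
    where open ℕₚ.≤-Reasoning

  count-pos⇒∃ : (f : Fin m → Bool) → 1 ≤ count f → ∃ λ j → f j ≡ true
  count-pos⇒∃ f pos with search f
  ... | inj₁ found = found
  ... | inj₂ none = ⊥-elim (<-irrefl (sym (count-none f none)) pos)

module _ {m : ℕ} (f : Fin m → Bool) where

  private
    ==⇒f : ∀ {i} → f i ≡ true → ∀ x → (x == i) ≡ true → f x ≡ true
    ==⇒f fi x x==i = subst (λ z → f z ≡ true) (sym (==⇒≡ x==i)) fi

  count≥2 : ∀ i j → i ≢ j → f i ≡ true → f j ≡ true → 2 ≤ count f
  count≥2 i j i≢j fi fj = begin
    2                                      ≡⟨ cong suc (count-single j) ⟨
    suc (count (_== j))                    ≡⟨ count-insert i (_== j) (≢⇒==-false i≢j) ⟨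
    count (λ x → (x == i) ∨ (x == j))      ≤⟨ count-mono pair⊆f ⟩
    count f                                ∎
    where
    open ℕₚ.≤-Reasoning
    pair⊆f : ∀ x → (x == i) ∨ (x == j) ≡ true → f x ≡ true
    pair⊆f x h with ∨-elim h
    ... | inj₁ x==i = ==⇒f fi x x==i
    ... | inj₂ x==j = ==⇒f fj x x==j

  count≥3 : ∀ i j l → i ≢ j → i ≢ l → j ≢ l → f i ≡ true → f j ≡ true → f l ≡ true → 3 ≤ count f
  count≥3 i j l i≢j i≢l j≢l fi fj fl = begin
    3                                              ≡⟨ cong (2 +_) (count-single l) ⟨
    2 + count (_== l)                              ≡⟨ cong suc (count-insert j (_== l) (≢⇒==-false j≢l)) ⟨
    suc (count (λ x → (x == j) ∨ (x == l)))        ≡⟨ count-insert i (λ x → (x == j) ∨ (x == l)) i∉jl ⟨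
    count (λ x → (x == i) ∨ ((x == j) ∨ (x == l))) ≤⟨ count-mono triple⊆f ⟩
    count f                                        ∎
    where
    open ℕₚ.≤-Reasoning
    i∉jl : (i == j) ∨ (i == l) ≡ false
    i∉jl rewrite ≢⇒==-false i≢j | ≢⇒==-false i≢l = refl
    triple⊆f : ∀ x → (x == i) ∨ ((x == j) ∨ (x == l)) ≡ true → f x ≡ true
    triple⊆f x h with ∨-elim h
    ... | inj₁ x==i = ==⇒f fi x x==i
    ... | inj₂ h′ with ∨-elim h′
    ...   | inj₁ x==j = ==⇒f fj x x==j
    ...   | inj₂ x==l = ==⇒f fl x x==l

count-≤ : ∀ {m} (f : Fin m → Bool) → count f ≤ m
count-≤ {zero} f = z≤n
count-≤ {suc m} f = +-mono-≤ (indicator≤1 (f zero)) (count-≤ (f ∘ suc))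
  where
  indicator≤1 : ∀ b → indicator b ≤ 1
  indicator≤1 false = z≤n
  indicator≤1 true = ≤-refl

module _ {n : ℕ} where

  _<ᵇ_ : Fin n → Fin n → Bool
  u <ᵇ v = ⌊ toℕ u <? toℕ v ⌋

  <⇒<ᵇ : {u v : Fin n} → toℕ u < toℕ v → u <ᵇ v ≡ true
  <⇒<ᵇ {u} {v} u<v with toℕ u <? toℕ v
  ... | yes _ = refl
  ... | no u≮v = ⊥-elim (u≮v u<v)

  ≥⇒<ᵇ-false : {u v : Fin n} → toℕ v ≤ toℕ u → u <ᵇ v ≡ false
  ≥⇒<ᵇ-false {u} {v} v≤u with toℕ u <? toℕ v
  ... | yes u<v = ⊥-elim (<-irrefl refl (<-≤-trans u<v v≤u))
  ... | no _ = refl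

  edgeCount : ESet n → ℕ
  edgeCount E = sum (λ u → count (λ v → (u <ᵇ v) ∧ E u v))

  countEdges≡edgeCount : (E : ESet n) → countEdges E ≡ edgeCount E
  countEdges≡edgeCount E = trans (foldr-map-allFin _+_ 0 (λ u → countℕ (row u))) (sum-cong-≗ (countℕ≡count ∘ row))
    where row : Fin n → Fin n → Bool
          row u v = (u <ᵇ v) ∧ E u v

  edgeCount-cong : {E F : ESet n} → (∀ u v → E u v ≡ F u v) → edgeCount E ≡ edgeCount F
  edgeCount-cong E≡F = sum-cong-≗ (λ u → count-cong (λ v → cong (_ ∧_) (E≡F u v)))

  edgeCount-mono : {E F : ESet n} → (∀ u v → E u v ≡ true → F u v ≡ true) → edgeCount E ≤ edgeCount F
  edgeCount-mono E⊆F = sum-mono-≤ (λ u → count-mono (λ v → ∧-monoʳ (u <ᵇ v) (E⊆F u v)))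

  edgeCount-mono-<-at : {E F : ESet n} → (∀ u v → E u v ≡ true → F u v ≡ true) →
    ∀ a b → toℕ a < toℕ b → E a b ≡ false → F a b ≡ true → edgeCount E < edgeCount F
  edgeCount-mono-<-at E⊆F a b a<b Eab Fab =
    sum-mono-< (λ u → count-mono (λ v → ∧-monoʳ (u <ᵇ v) (E⊆F u v))) a
      (count-mono-< (λ v → ∧-monoʳ (a <ᵇ v) (E⊆F a v)) b
        (trans (cong (_ ∧_) Eab) (∧-zeroʳ _)) (cong₂ _∧_ (<⇒<ᵇ a<b) Fab))

  -- {a, b} is counted once, at whichever of (a, b) and (b, a) is increasing.
  edgeCount-mono-< : {E F : ESet n} → (∀ u v → E u v ≡ true → F u v ≡ true) →
    ∀ a b → a ≢ b → E a b ≡ false → F a b ≡ true → E b a ≡ false → F b a ≡ true →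
    edgeCount E < edgeCount F
  edgeCount-mono-< E⊆F a b a≢b Eab Fab Eba Fba with ℕₚ.<-cmp (toℕ a) (toℕ b)
  ... | tri< a<b _ _ = edgeCount-mono-<-at E⊆F a b a<b Eab Fab
  ... | tri≈ _ a≡b _ = ⊥-elim (a≢b (Finₚ.toℕ-injective a≡b))
  ... | tri> _ _ b<a = edgeCount-mono-<-at E⊆F b a b<a Eba Fba

  edgeCount-none : (E : ESet n) → (∀ u v → E u v ≡ false) → edgeCount E ≡ 0
  edgeCount-none E none = sum-zero _ (λ u → count-none _ (λ v → trans (cong (_ ∧_) (none u v)) (∧-zeroʳ _)))

  edgeCount-pos : (E : ESet n) → ∀ a b → a ≢ b → E a b ≡ true → E b a ≡ true → 1 ≤ edgeCount E
  edgeCount-pos E a b a≢b Eab Eba = subst (_< edgeCount E) (edgeCount-none (λ _ _ → false) (λ _ _ → refl))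
    (edgeCount-mono-< (λ _ _ ()) a b a≢b refl Eab refl Eba)

  edgeCount-pos⇒∃ : (E : ESet n) → 1 ≤ edgeCount E → ∃₂ λ a b → E a b ≡ true
  edgeCount-pos⇒∃ E pos with search (λ a → anyFin (E a))
  ... | inj₁ (a , Ea) = a , anyFin⇒∃ (E a) Ea
  ... | inj₂ none = ⊥-elim (<-irrefl (sym (edgeCount-none E (λ a → anyFin-false (E a) (none a)))) pos)

  edgeCount-∨ : (E F : ESet n) → (∀ u v → E u v ∧ F u v ≡ false) →
    edgeCount (λ u v → E u v ∨ F u v) ≡ edgeCount E + edgeCount F
  edgeCount-∨ E F disjoint = begin
    edgeCount (λ u v → E u v ∨ F u v)
      ≡⟨ sum-cong-≗ (λ u → count-cong (λ v → ∧-distribˡ-∨ (u <ᵇ v) (E u v) (F u v))) ⟩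
    sum (λ u → count (λ v → ((u <ᵇ v) ∧ E u v) ∨ ((u <ᵇ v) ∧ F u v)))
      ≡⟨ sum-cong-≗ (λ u → count-∨ _ _ (λ v → ∧-disjointʳ (u <ᵇ v) (disjoint u v))) ⟩
    sum (λ u → count (λ v → (u <ᵇ v) ∧ E u v) + count (λ v → (u <ᵇ v) ∧ F u v))
      ≡⟨ ∑-distrib-+ (λ u → count (λ v → (u <ᵇ v) ∧ E u v)) (λ u → count (λ v → (u <ᵇ v) ∧ F u v)) ⟩
    edgeCount E + edgeCount F ∎
    where open ≡-Reasoning

  edgeCount-byLabel : ∀ {k} (L : Fin n → Fin k) (E : ESet n) →
    edgeCount E ≡ sum (λ i → edgeCount (λ u v → (L u == i) ∧ E u v))
  edgeCount-byLabel L E = trans (sum-byLabel L (λ u → count (λ v → (u <ᵇ v) ∧ E u v)))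
    (sum-cong-≗ (λ i → sum-cong-≗ (λ u → restrict i u)))
    where
    restrict : ∀ i u → (if L u == i then count (λ v → (u <ᵇ v) ∧ E u v) else 0)
                       ≡ count (λ v → (u <ᵇ v) ∧ ((L u == i) ∧ E u v))
    restrict i u with L u == i
    ... | true = refl
    ... | false = sym (count-none _ (λ v → ∧-zeroʳ (u <ᵇ v)))

  singleEdge : Fin n → Fin n → ESet n
  singleEdge x y a b = (a == x ∧ b == y) ∨ (a == y ∧ b == x)

  module _ {x y : Fin n} where

    singleEdge⇒ : ∀ a b → singleEdge x y a b ≡ true → (a ≡ x × b ≡ y) ⊎ (a ≡ y × b ≡ x)
    singleEdge⇒ _ _ h with ∨-elim h
    ... | inj₁ h = inj₁ (==⇒≡ (∧-elimˡ h) , ==⇒≡ (∧-elimʳ h))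
    ... | inj₂ h = inj₂ (==⇒≡ (∧-elimˡ h) , ==⇒≡ (∧-elimʳ h))

    singleEdge-false : ∀ {a b} → ¬ ((a ≡ x × b ≡ y) ⊎ (a ≡ y × b ≡ x)) → singleEdge x y a b ≡ false
    singleEdge-false {a} {b} ¬xy = ¬-not (¬xy ∘ singleEdge⇒ a b)

    singleEdge-flip : ∀ a b → singleEdge a b x y ≡ singleEdge x y a b
    singleEdge-flip a b = cong₂ _∨_ (cong₂ _∧_ (==-sym x a) (==-sym y b))
      (trans (cong₂ _∧_ (==-sym x b) (==-sym y a)) (∧-comm (b == x) (a == y)))

    singleEdge-sym : ∀ a b → singleEdge x y a b ≡ singleEdge x y b a
    singleEdge-sym a b = trans (∨-comm (a == x ∧ b == y) _)
      (cong₂ _∨_ (∧-comm (a == y) (b == x)) (∧-comm (a == x) (b == y)))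

  singleEdge-xy : ∀ x y → singleEdge x y x y ≡ true
  singleEdge-xy x y = ∨-introˡ _ (∧-intro (==-refl x) (==-refl y))

  singleEdge-yx : ∀ x y → singleEdge x y y x ≡ true
  singleEdge-yx x y = ∨-introʳ (y == x ∧ x == y) (∧-intro (==-refl y) (==-refl x))

  edgeCount-singleEdge-< : ∀ x y → toℕ x < toℕ y → edgeCount (singleEdge x y) ≡ 1
  edgeCount-singleEdge-< x y x<y = trans (sum-single _ x other-rows) (trans (count-cong row-x) (count-single y))
    where
    x≢y : x ≢ y
    x≢y refl = <-irrefl refl x<y
    other-rows : ∀ u → u ≢ x → count (λ v → (u <ᵇ v) ∧ singleEdge x y u v) ≡ 0
    other-rows u u≢x = count-none _ entry
      where
      entry : ∀ v → (u <ᵇ v) ∧ singleEdge x y u v ≡ false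
      entry v with singleEdge x y u v in e
      ... | false = ∧-zeroʳ (u <ᵇ v)
      ... | true with singleEdge⇒ {x = x} {y = y} u v e
      ...   | inj₁ (u≡x , _) = ⊥-elim (u≢x u≡x)
      ...   | inj₂ (refl , refl) = cong (_∧ true) (≥⇒<ᵇ-false (ℕₚ.<⇒≤ x<y))
    row-x : ∀ v → (x <ᵇ v) ∧ singleEdge x y x v ≡ (v == y)
    row-x v with toSum (v ≟ y)
    ... | inj₁ refl = trans (cong₂ _∧_ (<⇒<ᵇ x<y) (singleEdge-xy x y)) (sym (==-refl y))
    ... | inj₂ v≢y = trans (trans (cong (_ ∧_) (singleEdge-false not-xy)) (∧-zeroʳ _)) (sym (≢⇒==-false v≢y))
      where
      not-xy : ¬ ((x ≡ x × v ≡ y) ⊎ (x ≡ y × v ≡ x))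
      not-xy (inj₁ (_ , v≡y)) = v≢y v≡y
      not-xy (inj₂ (x≡y , _)) = x≢y x≡y

  edgeCount-singleEdge : ∀ {x y} → x ≢ y → edgeCount (singleEdge x y) ≡ 1
  edgeCount-singleEdge {x} {y} x≢y with ℕₚ.<-cmp (toℕ x) (toℕ y)
  ... | tri< x<y _ _ = edgeCount-singleEdge-< x y x<y
  ... | tri≈ _ x≡y _ = ⊥-elim (x≢y (Finₚ.toℕ-injective x≡y))
  ... | tri> _ _ y<x =
    trans (edgeCount-cong (λ a b → ∨-comm (a == x ∧ b == y) _)) (edgeCount-singleEdge-< y x y<x)

  edgeCount≡1⇒unique : (X : ESet n) → edgeCount X ≡ 1 → (∀ a b → X a b ≡ X b a) → (∀ a → X a a ≡ false) →
    ∀ {x y a b} → X x y ≡ true → X a b ≡ true → (a ≡ x × b ≡ y) ⊎ (a ≡ y × b ≡ x)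
  edgeCount≡1⇒unique X one X-sym irrefl {x} {y} {a} {b} Xxy Xab with singleEdge x y a b in e
  ... | true = singleEdge⇒ {x = x} {y = y} a b e
  ... | false = ⊥-elim (<-irrefl refl (≤-trans two (ℕₚ.≤-reflexive one)))
    where
    X-ab : ESet n
    X-ab u v = X u v ∧ not (singleEdge a b u v)
    loop : ∀ {u} → X u u ≡ true → ⊥
    loop Xuu = true≢false (trans (sym Xuu) (irrefl _))
    ab∌xy : singleEdge a b x y ≡ false
    ab∌xy = trans (singleEdge-flip a b) e
    removed : ∀ {u v} → singleEdge a b u v ≡ true → X-ab u v ≡ false
    removed {u} {v} uv = trans (cong (λ z → X u v ∧ not z) uv) (∧-zeroʳ _)
    two : 2 ≤ edgeCount X
    two = <-≤-trans (s≤s (edgeCount-pos X-ab x y (λ { refl → loop Xxy })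
                       (∧-intro Xxy (not-intro ab∌xy))
                       (∧-intro (trans (X-sym y x) Xxy) (not-intro (trans (singleEdge-sym y x) ab∌xy)))))
                    (edgeCount-mono-< (λ u v → ∧-elimˡ) a b (λ { refl → loop Xab })
                       (removed (singleEdge-xy a b)) Xab (removed (singleEdge-yx a b)) (trans (X-sym b a) Xab))

module _ {n : ℕ} where

  walk-map : {E F : ESet n} {S S′ : VSet n} →
    (∀ a b → E a b ≡ true → S b ≡ true → F a b ≡ true) → (∀ a → S a ≡ true → S′ a ≡ true) →
    ∀ {u v} → Walk E S u v → Walk F S′ u v
  walk-map E⊆F S⊆S′ here = here
  walk-map E⊆F S⊆S′ (step e s w) = step (E⊆F _ _ e s) (S⊆S′ _ s) (walk-map E⊆F S⊆S′ w)

  walk-++ : {E : ESet n} {S : VSet n} → ∀ {u w v} → Walk E S u w → Walk E S w v → Walk E S u v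
  walk-++ here q = q
  walk-++ (step e s p) q = step e s (walk-++ p q)

  walk-reverse : {E : ESet n} {S : VSet n} → (∀ a b → E a b ≡ E b a) →
    ∀ {u v} → Walk E S u v → S u ≡ true → Walk E S v u
  walk-reverse E-sym here _ = here
  walk-reverse E-sym (step {u} {w} e sw p) su = walk-++ (walk-reverse E-sym p sw) (step (trans (E-sym w u) e) su here)

  walk-end : {E : ESet n} {S : VSet n} → ∀ {u v} → Walk E S u v → S u ≡ true → S v ≡ true
  walk-end here su = su
  walk-end (step _ sw p) _ = walk-end p sw

  walk-length : {E : ESet n} {S : VSet n} → ∀ {u v} → Walk E S u v → ℕ
  walk-length here = 0
  walk-length (step _ _ p) = suc (walk-length p)

  walk-leaves : {E : ESet n} {S : VSet n} (X : VSet n) → ∀ {u v} → Walk E S u v → S u ≡ true →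
    X u ≡ true → X v ≡ false →
    ∃₂ λ a b → (E a b ≡ true) × (S a ≡ true) × (S b ≡ true) × (X a ≡ true) × (X b ≡ false)
  walk-leaves X here _ Xu Xv = ⊥-elim (true≢false (trans (sym Xu) Xv))
  walk-leaves X (step {u} {w} e sw p) su Xu Xv with X w in Xw
  ... | true = walk-leaves X p sw Xw Xv
  ... | false = u , w , e , su , sw , Xu , Xw

  restrict : ESet n → VSet n → ESet n
  restrict E S u v = E u v ∧ (S u ∧ S v)

  restrict⇒ : ∀ E S {u v} → restrict E S u v ≡ true → (E u v ≡ true) × (S u ≡ true) × (S v ≡ true)
  restrict⇒ E S {u} {v} h with E u v | S u | S v
  ... | true | true | true = refl , refl , refl

  restrict⇐ : ∀ E S {u v} → E u v ≡ true → S u ≡ true → S v ≡ true → restrict E S u v ≡ true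
  restrict⇐ _ _ Euv Su Sv = ∧-intro Euv (∧-intro Su Sv)

module ConnectedEdgeBound {n : ℕ} {E : ESet n} (E-sym : ∀ a b → E a b ≡ E b a) {S : VSet n}
  (conn : ∀ u v → S u ≡ true → S v ≡ true → Walk E S u v) where

  private
    _⊆_ : VSet n → VSet n → Set
    R ⊆ R′ = ∀ v → R v ≡ true → R′ v ≡ true

  boundary-edge : (R : VSet n) → R ⊆ S → 1 ≤ count R → count R < count S →
    ∃₂ λ a b → (E a b ≡ true) × (R a ≡ true) × (S b ≡ true) × (R b ≡ false)
  boundary-edge R R⊆S R≢∅ R⊂S with search (λ v → S v ∧ not (R v))
  ... | inj₂ S⊆R = ⊥-elim (<-irrefl refl (<-≤-trans R⊂S (count-mono S⊆R′)))
    where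
    S⊆R′ : S ⊆ R
    S⊆R′ v sv with R v in Rv | S⊆R v
    ... | true | _ = refl
    ... | false | S∖R∌v = ⊥-elim (true≢false (trans (sym (cong (_∧ true) sv)) S∖R∌v))
  ... | inj₁ (w , w∈S∖R) with count-pos⇒∃ R R≢∅
  ... | r , r∈R
    with walk-leaves R (conn r w (R⊆S r r∈R) (∧-elimˡ w∈S∖R)) (R⊆S r r∈R) r∈R (not-true (∧-elimʳ w∈S∖R))
  ... | a , b , Eab , _ , b∈S , a∈R , b∉R = a , b , Eab , a∈R , b∈S , b∉R

  add-vertex : (R : VSet n) → ∀ a b → E a b ≡ true → R a ≡ true → R b ≡ false →
    (count (λ v → (v == b) ∨ R v) ≡ suc (count R)) ×
    (edgeCount (restrict E R) < edgeCount (restrict E (λ v → (v == b) ∨ R v)))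
  add-vertex R a b Eab a∈R b∉R =
    count-insert b R b∉R ,
    edgeCount-mono-< (λ u v → restrict-mono u v) a b a≢b
      (trans (cong (λ z → E a b ∧ (R a ∧ z)) b∉R) (trans (cong (E a b ∧_) (∧-zeroʳ (R a))) (∧-zeroʳ _)))
      (restrict⇐ E (λ v → (v == b) ∨ R v) Eab (∨-introʳ (a == b) a∈R) (∨-introˡ (R b) (==-refl b)))
      (trans (cong (λ z → E b a ∧ (z ∧ R a)) b∉R) (∧-zeroʳ _))
      (restrict⇐ E (λ v → (v == b) ∨ R v) (trans (E-sym b a) Eab) (∨-introˡ (R b) (==-refl b)) (∨-introʳ (a == b) a∈R))
    where
    a≢b : a ≢ b
    a≢b refl = true≢false (trans (sym a∈R) b∉R)
    restrict-mono : ∀ u v → restrict E R u v ≡ true → restrict E (λ v → (v == b) ∨ R v) u v ≡ true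
    restrict-mono u v h with restrict⇒ E R h
    ... | Euv , Ru , Rv = restrict⇐ E (λ v → (v == b) ∨ R v) Euv (∨-introʳ (u == b) Ru) (∨-introʳ (v == b) Rv)

  subset-with-many-edges : ∀ m → suc m ≤ count S →
    ∃ λ R → R ⊆ S × (count R ≡ suc m) × (m ≤ edgeCount (restrict E R))
  subset-with-many-edges zero 1≤|S| with count-pos⇒∃ S 1≤|S|
  ... | s , s∈S = (_== s) , (λ v v==s → subst (λ x → S x ≡ true) (sym (==⇒≡ v==s)) s∈S) , count-single s , z≤n
  subset-with-many-edges (suc m) 2+m≤|S| with subset-with-many-edges m (≤-trans (ℕₚ.n≤1+n _) 2+m≤|S|)
  ... | R , R⊆S , |R| , edges
    with boundary-edge R R⊆S (subst (1 ≤_) (sym |R|) (s≤s z≤n)) (subst (_< count S) (sym |R|) 2+m≤|S|)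
  ... | a , b , Eab , a∈R , b∈S , b∉R with add-vertex R a b Eab a∈R b∉R
  ... | |R′| , more = (λ v → (v == b) ∨ R v) , R′⊆S , trans |R′| (cong suc |R|) , <-≤-trans (s≤s edges) more
    where
    R′⊆S : (λ v → (v == b) ∨ R v) ⊆ S
    R′⊆S v h with ∨-elim h
    ... | inj₁ v==b = subst (λ x → S x ≡ true) (sym (==⇒≡ v==b)) b∈S
    ... | inj₂ v∈R = R⊆S v v∈R

  size≤1+edgeCount : count S ≤ suc (edgeCount (restrict E S))
  size≤1+edgeCount with count S in |S|
  ... | zero = z≤n
  ... | suc m with subset-with-many-edges m (ℕₚ.≤-reflexive (sym |S|))
  ...   | R , R⊆S , _ , edges = s≤s (≤-trans edges (edgeCount-mono R-edges⊆S-edges))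
    where
    R-edges⊆S-edges : ∀ u v → restrict E R u v ≡ true → restrict E S u v ≡ true
    R-edges⊆S-edges u v h with restrict⇒ E R h
    ... | Euv , Ru , Rv = restrict⇐ E S Euv (R⊆S u Ru) (R⊆S v Rv)

module Split {n : ℕ} (E : ESet n) {S H : VSet n} (H⊆S : ∀ v → H v ≡ true → S v ≡ true) where

  R : VSet n
  R v = S v ∧ not (H v)

  crossing : ESet n
  crossing a b = E a b ∧ ((S a ∧ S b) ∧ (H a xor H b))

  private
    pair-split : ∀ sa sb ha hb → (ha ≡ true → sa ≡ true) → (hb ≡ true → sb ≡ true) →
      sa ∧ sb ≡ (ha ∧ hb) ∨ (((sa ∧ not ha) ∧ (sb ∧ not hb)) ∨ ((sa ∧ sb) ∧ (ha xor hb)))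
    pair-split true  true  true  true  _ _ = refl
    pair-split true  true  true  false _ _ = refl
    pair-split true  true  false true  _ _ = refl
    pair-split true  true  false false _ _ = refl
    pair-split true  false true  false _ _ = refl
    pair-split true  false false false _ _ = refl
    pair-split false true  false true  _ _ = refl
    pair-split false true  false false _ _ = refl
    pair-split false false false false _ _ = refl
    pair-split _     false _     true  _ h = ⊥-elim (true≢false (sym (h refl)))
    pair-split false _     true  _     h _ = ⊥-elim (true≢false (sym (h refl)))

    vertex-split : ∀ s h → (h ≡ true → s ≡ true) → s ≡ h ∨ (s ∧ not h)
    vertex-split true  true  _ = refl
    vertex-split true  false _ = refl
    vertex-split false false _ = refl
    vertex-split false true  h = ⊥-elim (true≢false (sym (h refl)))

    both-in-H-disjoint : ∀ sa sb ha hb →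
      (ha ∧ hb) ∧ (((sa ∧ not ha) ∧ (sb ∧ not hb)) ∨ ((sa ∧ sb) ∧ (ha xor hb))) ≡ false
    both-in-H-disjoint _     _     false _     = refl
    both-in-H-disjoint _     _     true  false = refl
    both-in-H-disjoint true  true  true  true  = refl
    both-in-H-disjoint true  false true  true  = refl
    both-in-H-disjoint false _     true  true  = refl

    both-in-R-disjoint : ∀ sa sb ha hb → ((sa ∧ not ha) ∧ (sb ∧ not hb)) ∧ ((sa ∧ sb) ∧ (ha xor hb)) ≡ false
    both-in-R-disjoint false _     _     _     = refl
    both-in-R-disjoint true  _     true  _     = refl
    both-in-R-disjoint true  false false _     = refl
    both-in-R-disjoint true  true  false true  = refl
    both-in-R-disjoint true  true  false false = refl

  edgeCount-split :
    edgeCount (restrict E S) ≡ edgeCount (restrict E H) + (edgeCount (restrict E R) + edgeCount crossing)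
  edgeCount-split = begin
    edgeCount (restrict E S)                                                        ≡⟨ edgeCount-cong split ⟩
    edgeCount (λ a b → restrict E H a b ∨ (restrict E R a b ∨ crossing a b))        ≡⟨ edgeCount-∨ _ _ H-disjoint ⟩
    edgeCount (restrict E H) + edgeCount (λ a b → restrict E R a b ∨ crossing a b)
      ≡⟨ cong (edgeCount (restrict E H) +_) (edgeCount-∨ _ _ R-disjoint) ⟩
    edgeCount (restrict E H) + (edgeCount (restrict E R) + edgeCount crossing)      ∎
    where
    open ≡-Reasoning
    split : ∀ a b → restrict E S a b ≡ (restrict E H a b ∨ (restrict E R a b ∨ crossing a b))
    split a b = trans (cong (E a b ∧_) (pair-split (S a) (S b) (H a) (H b) (H⊆S a) (H⊆S b)))
      (trans (∧-distribˡ-∨ (E a b) (H a ∧ H b) _) (cong (restrict E H a b ∨_) (∧-distribˡ-∨ (E a b) (R a ∧ R b) _)))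
    H-disjoint : ∀ a b → restrict E H a b ∧ (restrict E R a b ∨ crossing a b) ≡ false
    H-disjoint a b =
      trans (cong (restrict E H a b ∧_) (sym (∧-distribˡ-∨ (E a b) (R a ∧ R b) ((S a ∧ S b) ∧ (H a xor H b)))))
      (∧-disjointʳ (E a b) (both-in-H-disjoint (S a) (S b) (H a) (H b)))
    R-disjoint : ∀ a b → restrict E R a b ∧ crossing a b ≡ false
    R-disjoint a b = ∧-disjointʳ (E a b) (both-in-R-disjoint (S a) (S b) (H a) (H b))

  count-split : count S ≡ count H + count R
  count-split = trans (count-cong (λ v → vertex-split (S v) (H v) (H⊆S v)))
                      (count-∨ H R (λ v → disjoint (S v) (H v)))
    where
    disjoint : ∀ s h → h ∧ (s ∧ not h) ≡ false
    disjoint s false = refl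
    disjoint s true = ∧-zeroʳ s

InducesConnected-cong : (G : Graph) {S S′ : VSet (n G)} → (∀ v → S v ≡ S′ v) →
  InducesConnected G S → InducesConnected G S′
InducesConnected-cong G S≡S′ ((s , s∈S) , conn) =
  (s , trans (sym (S≡S′ s)) s∈S) ,
  λ u v u∈S′ v∈S′ → walk-map (λ _ _ e _ → e) (λ a a∈S → trans (sym (S≡S′ a)) a∈S)
                      (conn u v (trans (S≡S′ u) u∈S′) (trans (S≡S′ v) v∈S′))

adj⇒≢ : (G : Graph) → ∀ {u v} → adj G u v ≡ true → u ≢ v
adj⇒≢ G {u} e refl = true≢false (trans (sym e) (adj-irrefl G u))

module SpanningTree (G : Graph) {S : VSet (n G)} {T : ESet (n G)} (tree : IsSpanningTree G S T) where

  V : Set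
  V = Fin (n G)

  T-sym : ∀ u v → T u v ≡ T v u
  T-sym = proj₁ tree

  T⊆G[S] : ∀ u v → T u v ≡ true → (adj G u v ≡ true) × (S u ≡ true) × (S v ≡ true)
  T⊆G[S] = proj₁ (proj₂ tree)

  T-connected : ∀ u v → S u ≡ true → S v ≡ true → Walk T S u v
  T-connected = proj₁ (proj₂ (proj₂ tree))

  edgeCount-T : suc (edgeCount T) ≡ count S
  edgeCount-T = begin
    suc (edgeCount T)    ≡⟨ ℕₚ.+-comm 1 _ ⟩
    edgeCount T + 1      ≡⟨ cong (_+ 1) (countEdges≡edgeCount T) ⟨
    countEdges T + 1     ≡⟨ proj₂ (proj₂ (proj₂ tree)) ⟩
    size S               ≡⟨ countℕ≡count S ⟩
    count S              ∎
    where open ≡-Reasoning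

  T⇒≢ : ∀ {u v} → T u v ≡ true → u ≢ v
  T⇒≢ e = adj⇒≢ G (proj₁ (T⊆G[S] _ _ e))

  _－_ : V → V → ESet (n G)
  (x － y) a b = T a b ∧ not (singleEdge x y a b)

  －-sym : ∀ x y a b → (x － y) a b ≡ (x － y) b a
  －-sym x y a b = cong₂ (λ t e → t ∧ not e) (T-sym a b) (singleEdge-sym a b)

  －⊆T : ∀ x y a b → (x － y) a b ≡ true → T a b ≡ true
  －⊆T x y a b = ∧-elimˡ

  edgeCount-－ : ∀ x y → T x y ≡ true → edgeCount T ≡ suc (edgeCount (x － y))
  edgeCount-－ x y Txy = begin
    edgeCount T                                          ≡⟨ edgeCount-cong split ⟩
    edgeCount (λ a b → (x － y) a b ∨ singleEdge x y a b) ≡⟨ edgeCount-∨ _ _ disjoint ⟩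
    edgeCount (x － y) + edgeCount (singleEdge x y)      ≡⟨ cong (edgeCount (x － y) +_) (edgeCount-singleEdge (T⇒≢ Txy)) ⟩
    edgeCount (x － y) + 1                               ≡⟨ ℕₚ.+-comm _ 1 ⟩
    suc (edgeCount (x － y))                             ∎
    where
    open ≡-Reasoning
    split : ∀ a b → T a b ≡ ((x － y) a b ∨ singleEdge x y a b)
    split a b with singleEdge x y a b in e
    ... | false = sym (trans (∨-comm _ false) (∧-comm (T a b) true))
    ... | true with singleEdge⇒ {x = x} {y = y} a b e
    ...   | inj₁ (refl , refl) = trans Txy (sym (∨-zeroʳ _))
    ...   | inj₂ (refl , refl) = trans (trans (T-sym y x) Txy) (sym (∨-zeroʳ _))
    disjoint : ∀ a b → (x － y) a b ∧ singleEdge x y a b ≡ false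
    disjoint a b with singleEdge x y a b
    ... | true = trans (∧-comm _ true) (∧-zeroʳ (T a b))
    ... | false = ∧-zeroʳ _

  reach-endpoint : ∀ x y {z} → Walk T S z x → Walk (x － y) S z x ⊎ Walk (x － y) S z y
  reach-endpoint x y here = inj₁ here
  reach-endpoint x y (step {z} {w} Tzw sw p) with singleEdge x y z w in zw
  ... | true with singleEdge⇒ {x = x} {y = y} z w zw
  ...   | inj₁ (refl , _) = inj₁ here
  ...   | inj₂ (refl , _) = inj₂ here
  reach-endpoint x y (step {z} {w} Tzw sw p) | false with reach-endpoint x y p
  ...   | inj₁ q = inj₁ (step (∧-intro Tzw (not-intro zw)) sw q)
  ...   | inj₂ q = inj₂ (step (∧-intro Tzw (not-intro zw)) sw q)

  -- Otherwise T － xy would still connect S, with only |S| - 2 edges.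
  edge-removal-disconnects : ∀ x y → T x y ≡ true → ¬ Walk (x － y) S x y
  edge-removal-disconnects x y Txy x⇝y = <-irrefl refl (begin-strict
    count S                                      ≤⟨ ConnectedEdgeBound.size≤1+edgeCount (－-sym x y) S-connected ⟩
    suc (edgeCount (restrict (x － y) S))        <⟨ ℕₚ.n<1+n _ ⟩
    suc (suc (edgeCount (restrict (x － y) S)))  ≡⟨ cong (2 +_) (edgeCount-cong restrict-－) ⟩
    suc (suc (edgeCount (x － y)))               ≡⟨ cong suc (edgeCount-－ x y Txy) ⟨
    suc (edgeCount T)                            ≡⟨ edgeCount-T ⟩
    count S                                      ∎)
    where
    open ℕₚ.≤-Reasoning
    x∈S : S x ≡ true
    x∈S = proj₁ (proj₂ (T⊆G[S] x y Txy))
    to-x : ∀ z → S z ≡ true → Walk (x － y) S z x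
    to-x z z∈S with reach-endpoint x y (T-connected z x z∈S x∈S)
    ... | inj₁ z⇝x = z⇝x
    ... | inj₂ z⇝y = walk-++ z⇝y (walk-reverse (－-sym x y) x⇝y x∈S)
    S-connected : ∀ a b → S a ≡ true → S b ≡ true → Walk (x － y) S a b
    S-connected a b a∈S b∈S = walk-++ (to-x a a∈S) (walk-reverse (－-sym x y) (to-x b b∈S) b∈S)
    restrict-－ : ∀ a b → restrict (x － y) S a b ≡ (x － y) a b
    restrict-－ a b with (x － y) a b in e
    ... | false = refl
    ... | true with T⊆G[S] a b (－⊆T x y a b e)
    ...   | _ , a∈S , b∈S = cong₂ _∧_ a∈S b∈S

  -- W runs from the y-side of T － xy to its x-side, so it must cross xy from y to x.
  shortcut : ∀ x y → T x y ≡ true → ∀ {a v} (W : Walk T S a v) → S a ≡ true →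
    Walk (x － y) S a y → Walk (x － y) S v x → ∃ λ (W′ : Walk T S x v) → walk-length W′ < walk-length W
  shortcut x y Txy here a∈S a⇝y v⇝x =
    ⊥-elim (edge-removal-disconnects x y Txy (walk-++ (walk-reverse (－-sym x y) v⇝x a∈S) a⇝y))
  shortcut x y Txy (step {a} {b} Tab b∈S W) a∈S a⇝y v⇝x with singleEdge x y a b in ab
  ... | true with singleEdge⇒ {x = x} {y = y} a b ab
  ...   | inj₁ (refl , refl) = ⊥-elim (edge-removal-disconnects x y Txy a⇝y)
  ...   | inj₂ (refl , refl) = W , ≤-refl
  shortcut x y Txy (step {a} {b} Tab b∈S W) a∈S a⇝y v⇝x | false
    with shortcut x y Txy W b∈S (step (trans (－-sym x y b a) (∧-intro Tab (not-intro ab))) a∈S a⇝y) v⇝x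
  ... | W′ , shorter = W′ , ℕₚ.m<n⇒m<1+n shorter

  separating-edge-within : ∀ fuel {u v} (W : Walk T S u v) → walk-length W ≤ fuel → S u ≡ true → u ≢ v →
    ∃₂ λ x y → (T x y ≡ true) × Walk (x － y) S u x × Walk (x － y) S v y
  separating-edge-within _ here _ _ u≢v = ⊥-elim (u≢v refl)
  separating-edge-within (suc fuel) {u} {v} (step {u} {w} Tuw w∈S W) (s≤s short) u∈S u≢v
    with reach-endpoint u w (T-connected v u (walk-end W w∈S) u∈S)
  ... | inj₂ v⇝w = u , w , Tuw , here , v⇝w
  ... | inj₁ v⇝u with shortcut u w Tuw W w∈S here v⇝u
  ...   | W′ , shorter = separating-edge-within fuel W′ (ℕₚ.<⇒≤ (<-≤-trans shorter short)) u∈S u≢v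

  separating-edge : ∀ u v → S u ≡ true → S v ≡ true → u ≢ v →
    ∃₂ λ x y → (T x y ≡ true) × Walk (x － y) S u x × Walk (x － y) S v y
  separating-edge u v u∈S v∈S = separating-edge-within _ (T-connected u v u∈S v∈S) ≤-refl u∈S

  exchange : ∀ {x y u v} → T x y ≡ true → S u ≡ true → S v ≡ true → adj G u v ≡ true → T u v ≡ false →
    Walk (x － y) S u x → Walk (x － y) S v y →
    IsSpanningTree G S (λ a b → (x － y) a b ∨ singleEdge u v a b)
  exchange {x} {y} {u} {v} Txy u∈S v∈S Guv ¬Tuv u⇝x v⇝y = T′-sym , T′⊆G[S] , T′-connected , T′-count
    where
    T′ : ESet (n G)
    T′ a b = (x － y) a b ∨ singleEdge u v a b
    T′-sym : ∀ a b → T′ a b ≡ T′ b a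
    T′-sym a b = cong₂ _∨_ (－-sym x y a b) (singleEdge-sym a b)
    T′⊆G[S] : ∀ a b → T′ a b ≡ true → (adj G a b ≡ true) × (S a ≡ true) × (S b ≡ true)
    T′⊆G[S] a b h with ∨-elim h
    ... | inj₁ old = T⊆G[S] a b (－⊆T x y a b old)
    ... | inj₂ new with singleEdge⇒ {x = u} {y = v} a b new
    ...   | inj₁ (refl , refl) = Guv , u∈S , v∈S
    ...   | inj₂ (refl , refl) = trans (adj-sym G v u) Guv , v∈S , u∈S
    lift : ∀ {a b} → Walk (x － y) S a b → Walk T′ S a b
    lift = walk-map (λ a b old _ → ∨-introˡ _ old) (λ _ a∈S → a∈S)
    y⇝x : Walk T′ S y x
    y⇝x = walk-++ (lift (walk-reverse (－-sym x y) v⇝y v∈S))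
                  (step (∨-introʳ ((x － y) v u) (singleEdge-yx u v)) u∈S (lift u⇝x))
    x∈S : S x ≡ true
    x∈S = proj₁ (proj₂ (T⊆G[S] x y Txy))
    to-x : ∀ z → S z ≡ true → Walk T′ S z x
    to-x z z∈S with reach-endpoint x y (T-connected z x z∈S x∈S)
    ... | inj₁ z⇝x = lift z⇝x
    ... | inj₂ z⇝y = walk-++ (lift z⇝y) y⇝x
    T′-connected : ∀ a b → S a ≡ true → S b ≡ true → Walk T′ S a b
    T′-connected a b a∈S b∈S = walk-++ (to-x a a∈S) (walk-reverse T′-sym (to-x b b∈S) b∈S)
    disjoint : ∀ a b → (x － y) a b ∧ singleEdge u v a b ≡ false
    disjoint a b with singleEdge u v a b in e
    ... | false = ∧-zeroʳ _
    ... | true with singleEdge⇒ {x = u} {y = v} a b e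
    ...   | inj₁ (refl , refl) = cong (λ t → (t ∧ not (singleEdge x y u v)) ∧ true) ¬Tuv
    ...   | inj₂ (refl , refl) = cong (λ t → (t ∧ not (singleEdge x y v u)) ∧ true) (trans (T-sym v u) ¬Tuv)
    T′-count : countEdges T′ + 1 ≡ size S
    T′-count = begin
      countEdges T′ + 1                                    ≡⟨ cong (_+ 1) (countEdges≡edgeCount T′) ⟩
      edgeCount T′ + 1                                     ≡⟨ cong (_+ 1) (edgeCount-∨ _ _ disjoint) ⟩
      edgeCount (x － y) + edgeCount (singleEdge u v) + 1
        ≡⟨ cong (λ m → edgeCount (x － y) + m + 1) (edgeCount-singleEdge (adj⇒≢ G Guv)) ⟩
      edgeCount (x － y) + 1 + 1                           ≡⟨ cong (_+ 1) (ℕₚ.+-comm _ 1) ⟩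
      suc (edgeCount (x － y)) + 1                         ≡⟨ cong (_+ 1) (edgeCount-－ x y Txy) ⟨
      edgeCount T + 1                                      ≡⟨ cong (_+ 1) (countEdges≡edgeCount T) ⟨
      countEdges T + 1                                     ≡⟨ proj₂ (proj₂ (proj₂ tree)) ⟩
      size S                                               ∎
      where open ≡-Reasoning

module UniqueSpanningTree (G : Graph) {S : VSet (n G)} {T : ESet (n G)} (unique : IsUniqueSpanningTree G S T) where
  open SpanningTree G (proj₁ unique) public

  contains-induced : ∀ u v → S u ≡ true → S v ≡ true → adj G u v ≡ true → T u v ≡ true
  contains-induced u v u∈S v∈S Guv with T u v in Tuv
  ... | true = refl
  ... | false with separating-edge u v u∈S v∈S (adj⇒≢ G Guv)
  ...   | x , y , Txy , u⇝x , v⇝y =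
    ⊥-elim (true≢false (trans (sym (∨-introʳ ((x － y) u v) (singleEdge-xy u v)))
                              (trans (proj₂ unique _ (exchange Txy u∈S v∈S Guv Tuv u⇝x v⇝y) u v) Tuv)))

  T≡G[S] : ∀ u v → T u v ≡ restrict (adj G) S u v
  T≡G[S] u v with T u v in Tuv
  ... | true with T⊆G[S] u v Tuv
  ...   | Guv , u∈S , v∈S = sym (restrict⇐ (adj G) S Guv u∈S v∈S)
  T≡G[S] u v | false with adj G u v in Guv | S u in u∈S | S v in v∈S
  ... | true | true | true = ⊥-elim (true≢false (trans (sym (contains-induced u v u∈S v∈S Guv)) Tuv))
  ... | false | _ | _ = refl
  ... | true | false | _ = refl
  ... | true | true | false = refl

  edgeCount-G[S] : suc (edgeCount (restrict (adj G) S)) ≡ count S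
  edgeCount-G[S] = trans (cong suc (sym (edgeCount-cong T≡G[S]))) edgeCount-T

  -- Counting: G[S] has |S| - 1 edges, while G[H] and G[S ∖ H] have at least |H| - 1 and |S ∖ H| - 1.
  one-crossing-edge : (H : VSet (n G)) (H⊆S : ∀ v → H v ≡ true → S v ≡ true) →
    InducesConnected G H → InducesConnected G (λ v → S v ∧ not (H v)) →
    edgeCount (Split.crossing (adj G) H⊆S) ≡ 1
  one-crossing-edge H H⊆S ((h , h∈H) , H-conn) ((r , r∈R) , R-conn) = ℕₚ.≤-antisym at-most-one at-least-one
    where
    open Split (adj G) H⊆S
    eH eR : ℕ
    eH = edgeCount (restrict (adj G) H)
    eR = edgeCount (restrict (adj G) R)
    at-most-one : edgeCount crossing ≤ 1
    at-most-one = ℕₚ.+-cancelˡ-≤ eR _ _ (ℕₚ.+-cancelˡ-≤ eH _ _ (ℕₚ.≤-pred (begin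
      suc (eH + (eR + edgeCount crossing))  ≡⟨ cong suc edgeCount-split ⟨
      suc (edgeCount (restrict (adj G) S))  ≡⟨ edgeCount-G[S] ⟩
      count S                               ≡⟨ count-split ⟩
      count H + count R                     ≤⟨ +-mono-≤ (ConnectedEdgeBound.size≤1+edgeCount (adj-sym G) H-conn)
                                                         (ConnectedEdgeBound.size≤1+edgeCount (adj-sym G) R-conn) ⟩
      suc eH + suc eR                       ≡⟨ cong (λ m → suc (eH + m)) (ℕₚ.+-comm 1 eR) ⟩
      suc (eH + (eR + 1))                   ∎)))
      where open ℕₚ.≤-Reasoning
    at-least-one : 1 ≤ edgeCount crossing
    at-least-one with walk-leaves H (T-connected h r (H⊆S h h∈H) (∧-elimˡ r∈R)) (H⊆S h h∈H) h∈H (not-true (∧-elimʳ r∈R))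
    ... | a , b , Tab , a∈S , b∈S , a∈H , b∉H with T⊆G[S] a b Tab
    ...   | Gab , _ = edgeCount-pos crossing a b (T⇒≢ Tab) (crossing-ab Gab) (crossing-ba (trans (adj-sym G b a) Gab))
      where
      crossing-ab : adj G a b ≡ true → crossing a b ≡ true
      crossing-ab Gab rewrite Gab | a∈S | b∈S | a∈H | b∉H = refl
      crossing-ba : adj G b a ≡ true → crossing b a ≡ true
      crossing-ba Gba rewrite Gba | a∈S | b∈S | a∈H | b∉H = refl

  module Colouring {k : ℕ} (L : V → Fin k) where

    bichromatic : ESet (n G)
    bichromatic a b = adj G a b ∧ ((S a ∧ S b) ∧ not (L a == L b))

    bichromatic-sym : ∀ a b → bichromatic a b ≡ bichromatic b a
    bichromatic-sym a b = cong₂ _∧_ (adj-sym G a b) (cong₂ _∧_ (∧-comm (S a) (S b)) (cong not (==-sym (L a) (L b))))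

    bichromatic-irrefl : ∀ a → bichromatic a a ≡ false
    bichromatic-irrefl a rewrite adj-irrefl G a = refl

    T⇒bichromatic : ∀ {a b} → T a b ≡ true → L a ≢ L b → bichromatic a b ≡ true
    T⇒bichromatic {a} {b} Tab La≢Lb with T⊆G[S] a b Tab
    ... | Gab , a∈S , b∈S rewrite Gab | a∈S | b∈S | ≢⇒==-false La≢Lb = refl

    bichromatic⇒≢ : ∀ {a b} → bichromatic a b ≡ true → L a ≢ L b
    bichromatic⇒≢ {a} {b} h La≡Lb = true≢false (trans (sym (∧-elimʳ (∧-elimʳ {adj G a b} h)))
                                                   (cong not (≡⇒== La≡Lb)))

    bichromatic⇒S : ∀ {a b} → bichromatic a b ≡ true → S a ≡ true
    bichromatic⇒S {a} {b} h = ∧-elimˡ (∧-elimˡ (∧-elimʳ {adj G a b} h))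

    bichromatic-pos : ∀ u v → S u ≡ true → S v ≡ true → L u ≢ L v → 1 ≤ edgeCount bichromatic
    bichromatic-pos u v u∈S v∈S Lu≢Lv
      with walk-leaves (λ z → L z == L u) (T-connected u v u∈S v∈S) u∈S (==-refl (L u)) (≢⇒==-false (Lu≢Lv ∘ sym))
    ... | a , b , Tab , _ , _ , a∼u , b≁u = edgeCount-pos bichromatic a b (T⇒≢ Tab)
          (T⇒bichromatic Tab La≢Lb) (trans (bichromatic-sym b a) (T⇒bichromatic Tab La≢Lb))
      where
      La≢Lb : L a ≢ L b
      La≢Lb La≡Lb = true≢false (trans (sym a∼u) (trans (cong (_== L u) La≡Lb) b≁u))

    module OneBichromaticEdge (one : edgeCount bichromatic ≡ 1) {x y : V} (xy : bichromatic x y ≡ true) where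

      only : ∀ {a b} → bichromatic a b ≡ true → (a ≡ x × b ≡ y) ⊎ (a ≡ y × b ≡ x)
      only = edgeCount≡1⇒unique bichromatic one bichromatic-sym bichromatic-irrefl xy

      Lx≢Ly : L x ≢ L y
      Lx≢Ly = bichromatic⇒≢ xy

      x∈S : S x ≡ true
      x∈S = bichromatic⇒S xy

      two-colours-along : ∀ {a z} → Walk T S a z → S a ≡ true → (L a ≡ L x ⊎ L a ≡ L y) → (L z ≡ L x ⊎ L z ≡ L y)
      two-colours-along here _ La = La
      two-colours-along (step {a} {w} Taw w∈S W) a∈S La with toSum (L a ≟ L w)
      ... | inj₁ La≡Lw = two-colours-along W w∈S (Data.Sum.map (trans (sym La≡Lw)) (trans (sym La≡Lw)) La)
      ... | inj₂ La≢Lw with only (T⇒bichromatic Taw La≢Lw)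
      ...   | inj₁ (_ , refl) = two-colours-along W w∈S (inj₂ refl)
      ...   | inj₂ (_ , refl) = two-colours-along W w∈S (inj₁ refl)

      two-colours : ∀ z → S z ≡ true → L z ≡ L x ⊎ L z ≡ L y
      two-colours z z∈S = two-colours-along (T-connected x z x∈S z∈S) x∈S (inj₁ refl)

      C : VSet (n G)
      C v = S v ∧ (L v == L x)

      x∈C : C x ≡ true
      x∈C = ∧-intro x∈S (==-refl (L x))

      -- A tree walk can only enter C through the edge yx, i.e. at x.
      class-walk : ∀ {u v} → Walk T S u v → S u ≡ true → C v ≡ true →
        (C u ≡ true → Walk (adj G) C u v) × (C u ≡ false → Walk (adj G) C x v)
      class-walk here _ v∈C = (λ _ → here) , (λ v∉C → ⊥-elim (true≢false (trans (sym v∈C) v∉C)))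
      class-walk {v = v} (step {u} {w} Tuw w∈S W) u∈S v∈C with class-walk W w∈S v∈C | C w in Cw | C u in Cu
      ... | from-w , _ | true | true = (λ _ → step (proj₁ (T⊆G[S] u w Tuw)) Cw (from-w Cw)) , λ ()
      ... | _ , from-x | false | true = (λ _ → left) , λ ()
        where
        Lu≢Lw : L u ≢ L w
        Lu≢Lw Lu≡Lw = true≢false (trans (sym Cu) (trans (cong₂ (λ s l → s ∧ (l == L x)) (trans u∈S (sym w∈S)) Lu≡Lw) Cw))
        left : Walk (adj G) C u v
        left with only (T⇒bichromatic Tuw Lu≢Lw)
        ... | inj₁ (refl , _) = from-x Cw
        ... | inj₂ (_ , refl) = ⊥-elim (true≢false (trans (sym x∈C) Cw))
      ... | _ , from-x | false | false = (λ ()) , (λ _ → from-x Cw)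
      ... | from-w , _ | true | false = (λ ()) , λ _ → entered
        where
        Lu≢Lw : L u ≢ L w
        Lu≢Lw Lu≡Lw = true≢false (trans (sym Cw) (trans (cong₂ (λ s l → s ∧ (l == L x)) (trans w∈S (sym u∈S)) (sym Lu≡Lw)) Cu))
        entered : Walk (adj G) C x v
        entered with only (T⇒bichromatic Tuw Lu≢Lw)
        ... | inj₁ (refl , _) = ⊥-elim (true≢false (trans (sym x∈C) Cu))
        ... | inj₂ (_ , refl) = from-w Cw

      C-connected : InducesConnected G C
      C-connected = (x , x∈C) , λ a b a∈C b∈C →
        proj₁ (class-walk (T-connected a b (∧-elimˡ a∈C) (∧-elimˡ b∈C)) (∧-elimˡ a∈C) b∈C) a∈C

module Population {n : ℕ} (p : Fin n → ℚ) (positive : ∀ v → 0ℚ <ℚ p v) where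

  popSum≡sum : (S : VSet n) → popSum p S ≡ ℚSum.sum (λ v → if S v then p v else 0ℚ)
  popSum≡sum S = foldr-map-allFin Data.Rational._+_ 0ℚ (λ v → if S v then p v else 0ℚ)

  popSum-mono-< : (S S′ : VSet n) → (∀ v → S v ≡ true → S′ v ≡ true) → ∀ w → S′ w ≡ true → S w ≡ false →
    popSum p S <ℚ popSum p S′
  popSum-mono-< S S′ S⊆S′ w w∈S′ w∉S = subst₂ _<ℚ_ (sym (popSum≡sum S)) (sym (popSum≡sum S′))
    (ℚSum.sum-mono-< term-≤ w
      (subst₂ (λ a b → (if a then p w else 0ℚ) <ℚ (if b then p w else 0ℚ)) (sym w∉S) (sym w∈S′) (positive w)))
    where
    term-≤ : ∀ v → (if S v then p v else 0ℚ) ≤ℚ (if S′ v then p v else 0ℚ)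
    term-≤ v with S v in Sv | S′ v in S′v
    ... | true | true = ℚₚ.≤-refl
    ... | false | false = ℚₚ.≤-refl
    ... | false | true = ℚₚ.<⇒≤ (positive v)
    ... | true | false = ⊥-elim (true≢false (trans (sym (S⊆S′ v Sv)) S′v))

  equal-population-⊆⇒⊇ : ∀ {k k′} (M : Fin n → Fin k) (M′ : Fin n → Fin k′) i j →
    popSum p (part M i) ≡ popSum p (part M′ j) → (∀ v → M v ≡ i → M′ v ≡ j) → ∀ v → M′ v ≡ j → M v ≡ i
  equal-population-⊆⇒⊇ M M′ i j same ⊆ v M′v≡j with toSum (M v ≟ i)
  ... | inj₁ Mv≡i = Mv≡i
  ... | inj₂ Mv≢i = ⊥-elim (ℚₚ.<-irrefl same
        (popSum-mono-< (part M i) (part M′ j) (λ w h → ≡⇒== (⊆ w (==⇒≡ h))) v (≡⇒== M′v≡j) (≢⇒==-false Mv≢i)))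

  total-population : ∀ {k} (M : Fin n → Fin k) → ℚSum.sum p ≡ ℚSum.sum (λ i → popSum p (part M i))
  total-population M = trans (ℚSum.sum-byLabel M p) (ℚSum.sum-cong-≗ (λ i → sym (popSum≡sum (part M i))))

  -- Both partitions split the same total into k equal shares.
  balanced-populations-agree : ∀ {k} (M M′ : Fin n → Fin k) →
    (∀ i j → popSum p (part M i) ≡ popSum p (part M j)) → (∀ i j → popSum p (part M′ i) ≡ popSum p (part M′ j)) →
    ∀ i j → popSum p (part M i) ≡ popSum p (part M′ j)
  balanced-populations-agree {k} M M′ M-balanced M′-balanced i j = trans shares-agree (M′-balanced i j)
    where
    c c′ : ℚ
    c = popSum p (part M i)
    c′ = popSum p (part M′ i)
    total≡ : ∀ (N : Fin n → Fin k) → (∀ i′ → popSum p (part N i′) ≡ popSum p (part N i)) →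
      ℚSum.sum p ≡ ℚSum.sum {k} (λ _ → popSum p (part N i))
    total≡ N balanced = trans (total-population N) (ℚSum.sum-cong-≗ balanced)
    totals-agree : ℚSum.sum {k} (λ _ → c) ≡ ℚSum.sum {k} (λ _ → c′)
    totals-agree = trans (sym (total≡ M (λ i′ → M-balanced i′ i))) (total≡ M′ (λ i′ → M′-balanced i′ i))
    shares-agree : c ≡ c′
    shares-agree with ℚₚ.<-cmp c c′
    ... | tri≈ _ c≡c′ _ = c≡c′
    ... | tri< c<c′ _ _ = ⊥-elim (ℚₚ.<-irrefl totals-agree (ℚSum.sum-mono-< (λ _ → ℚₚ.<⇒≤ c<c′) i c<c′))
    ... | tri> _ _ c′<c = ⊥-elim (ℚₚ.<-irrefl (sym totals-agree) (ℚSum.sum-mono-< (λ _ → ℚₚ.<⇒≤ c′<c) i c′<c))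

toℕ-cnext-< : ∀ {m} (t : Fin (suc m)) → toℕ t < m → toℕ (cnext t) ≡ suc (toℕ t)
toℕ-cnext-< {suc m} zero _ = refl
toℕ-cnext-< {suc m} (suc t) (s≤s t<m) with cnext t | toℕ-cnext-< t t<m
... | suc r | e = cong suc e

toℕ-cnext-last : ∀ {m} (t : Fin (suc m)) → toℕ t ≡ m → toℕ (cnext t) ≡ 0
toℕ-cnext-last {zero} zero _ = refl
toℕ-cnext-last {suc m} (suc t) e with cnext t | toℕ-cnext-last t (ℕₚ.suc-injective e)
... | zero | _ = refl

cnext-cases : ∀ {m} (t : Fin (suc m)) →
  (toℕ t < m × toℕ (cnext t) ≡ suc (toℕ t)) ⊎ (toℕ t ≡ m × toℕ (cnext t) ≡ 0)
cnext-cases {m} t with ℕₚ.m≤n⇒m<n∨m≡n (ℕₚ.≤-pred (Finₚ.toℕ<n t))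
... | inj₁ t<m = inj₁ (t<m , toℕ-cnext-< t t<m)
... | inj₂ t≡m = inj₂ (t≡m , toℕ-cnext-last t t≡m)

cnext-≢ : ∀ {m} (t : Fin (suc (suc m))) → cnext t ≢ t
cnext-≢ t e with cnext-cases t
... | inj₁ (_ , next) = ℕₚ.1+n≢n (trans (sym next) (cong toℕ e))
... | inj₂ (last , next) = ℕₚ.1+n≢0 (trans (sym last) (trans (cong toℕ (sym e)) next))

cnext-injective : ∀ {m} (s t : Fin (suc m)) → cnext s ≡ cnext t → s ≡ t
cnext-injective s t e with cnext-cases s | cnext-cases t
... | inj₁ (_ , next-s) | inj₁ (_ , next-t) =
  Finₚ.toℕ-injective (ℕₚ.suc-injective (trans (sym next-s) (trans (cong toℕ e) next-t)))
... | inj₂ (last-s , _) | inj₂ (last-t , _) = Finₚ.toℕ-injective (trans last-s (sym last-t))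
... | inj₁ (_ , next-s) | inj₂ (_ , next-t) = ⊥-elim (ℕₚ.1+n≢0 (trans (sym next-s) (trans (cong toℕ e) next-t)))
... | inj₂ (_ , next-s) | inj₁ (_ , next-t) = ⊥-elim (ℕₚ.1+n≢0 (trans (sym next-t) (trans (cong toℕ (sym e)) next-s)))

cnext-surjective : ∀ {m} (t : Fin (suc m)) → ∃ λ t′ → cnext t′ ≡ t
cnext-surjective {m} t with toℕ t in et
... | zero = Data.Fin.fromℕ m , Finₚ.toℕ-injective (trans (toℕ-cnext-last _ (Finₚ.toℕ-fromℕ m)) (sym et))
... | suc s = t′ , Finₚ.toℕ-injective (trans (toℕ-cnext-< t′ t′<m) (trans (cong suc (Finₚ.toℕ-fromℕ< s<1+m)) (sym et)))
  where
  s<m : s < m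
  s<m = ℕₚ.≤-pred (subst (_< suc m) et (Finₚ.toℕ<n t))
  s<1+m : s < suc m
  s<1+m = ℕₚ.m<n⇒m<1+n s<m
  t′ : Fin (suc m)
  t′ = Data.Fin.fromℕ< s<1+m
  t′<m : toℕ t′ < m
  t′<m = subst (_< m) (sym (Finₚ.toℕ-fromℕ< s<1+m)) s<m

module _ {n k : ℕ} (P Q : Fin n → Fin k) where

  isPartOf⇒ : ∀ i → isPartOf P i Q ≡ true → ∃ λ j → ∀ v → (P v == i) ≡ (Q v == j)
  isPartOf⇒ i h with anyFin⇒∃ _ h
  ... | j , same = j , agree
    where
    agree : ∀ v → (P v == i) ≡ (Q v == j)
    agree v with P v == i | Q v == j | allFin?⇒∀ _ same v
    ... | true | true | _ = refl
    ... | false | false | _ = refl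

  isPartOf⇐ : ∀ i j → (∀ v → (P v == i) ≡ (Q v == j)) → isPartOf P i Q ≡ true
  isPartOf⇐ i j same with isPartOf P i Q in e
  ... | true = refl
  ... | false with allFin?-false _ (anyFin-false _ e j)
  ...   | v , disagree with P v == i | Q v == j | same v | disagree
  ...     | true | true | _ | ()
  ...     | false | false | _ | ()

edgeIn-adjacent : (G : Graph) {k : ℕ} (M : Fin (n G) → Fin k) {T : Fin k → ESet (n G)} →
  (∀ i → IsUniqueSpanningTree G (part M i) (T i)) → ∀ u v → adj G u v ≡ true → edgeIn T u v ≡ (M u == M v)
edgeIn-adjacent G M {T} unique u v Guv with toSum (M u ≟ M v)
... | inj₁ same = trans (∃⇒anyFin (λ i → T i u v) (M u) Tuv) (sym (≡⇒== same))
  where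
  Tuv : T (M u) u v ≡ true
  Tuv = trans (UniqueSpanningTree.T≡G[S] G (unique (M u)) u v)
              (restrict⇐ (adj G) (part M (M u)) Guv (==-refl (M u)) (≡⇒== (sym same)))
... | inj₂ different = trans (¬-not notIn) (sym (≢⇒==-false different))
  where
  notIn : edgeIn T u v ≢ true
  notIn h with anyFin⇒∃ (λ i → T i u v) h
  ... | i , Tiuv with UniqueSpanningTree.T⊆G[S] G (unique i) u v Tiuv
  ...   | _ , Mu≡i , Mv≡i = different (trans (==⇒≡ Mu≡i) (sym (==⇒≡ Mv≡i)))

module Comparison (G : Graph) {k : ℕ} (L L̃ : Fin (n G) → Fin k) {T T̃ : Fin k → ESet (n G)}
  (T-unique : ∀ i → IsUniqueSpanningTree G (part L i) (T i))
  (T̃-unique : ∀ i → IsUniqueSpanningTree G (part L̃ i) (T̃ i)) where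

  V : Set
  V = Fin (n G)

  module Part (i : Fin k) = UniqueSpanningTree G (T-unique i)

  cut : Fin k → ESet (n G)
  cut i = Part.Colouring.bichromatic i L̃

  changed : Fin k → Bool
  changed i = not (isPartOf L i L̃)

  partsNotIn≡ : partsNotIn L L̃ ≡ count changed
  partsNotIn≡ = countℕ≡count changed

  edgesNotIn≡ : edgesNotIn G T T̃ ≡ sum (λ i → edgeCount (cut i))
  edgesNotIn≡ = begin
    edgesNotIn G T T̃
      ≡⟨ countEdges≡edgeCount (λ u v → adj G u v ∧ edgeIn T u v ∧ not (edgeIn T̃ u v)) ⟩
    edgeCount (λ u v → adj G u v ∧ edgeIn T u v ∧ not (edgeIn T̃ u v))  ≡⟨ edgeCount-cong by-labels ⟩
    edgeCount lost                                                     ≡⟨ edgeCount-byLabel L lost ⟩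
    sum (λ i → edgeCount (λ u v → (L u == i) ∧ lost u v))              ≡⟨ sum-cong-≗ (λ i → edgeCount-cong (within i)) ⟩
    sum (λ i → edgeCount (cut i))                                      ∎
    where
    open ≡-Reasoning
    lost : ESet (n G)
    lost u v = adj G u v ∧ ((L u == L v) ∧ not (L̃ u == L̃ v))
    by-labels : ∀ u v → (adj G u v ∧ edgeIn T u v ∧ not (edgeIn T̃ u v)) ≡ lost u v
    by-labels u v with adj G u v in Guv
    ... | false = refl
    ... | true rewrite edgeIn-adjacent G L T-unique u v Guv | edgeIn-adjacent G L̃ T̃-unique u v Guv = refl
    within : ∀ i u v → ((L u == i) ∧ lost u v) ≡ cut i u v
    within i u v with toSum (L u ≟ i)
    ... | inj₁ refl rewrite ==-refl (L u) | ==-sym (L v) (L u) = refl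
    ... | inj₂ Lu≢i rewrite ≢⇒==-false Lu≢i = sym (∧-zeroʳ (adj G u v))

  module FromBUD (nonempty : ∀ i → ∃ λ v → L v ≡ i)
    (r : ℕ) (C : Fin r → QCycle G L) (B : (a : Fin r) → BUDChoice G L (C a))
    (disjoint : ∀ a b (ja : Fin (2 + len₋₂ (C a))) (jb : Fin (2 + len₋₂ (C b))) →
                a ≢ b → cpart (C a) ja ≢ cpart (C b) jb)
    (Q : V → Fin k)
    (Q-spec : ∀ v → (∀ a j → L v ≡ cpart (C a) j → H (B a) j v ≡ true → Q v ≡ cpart (C a) (cnext j)) ×
                    ((∀ a j → ¬ ((L v ≡ cpart (C a) j) × (H (B a) j v ≡ true))) → Q v ≡ L v))
    (Q∼L̃ : SamePartition Q L̃) where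

    same-L̃≡same-Q : ∀ u v → (L̃ u == L̃ v) ≡ (Q u == Q v)
    same-L̃≡same-Q u v with toSum (L̃ u ≟ L̃ v)
    ... | inj₁ e = trans (≡⇒== e) (sym (≡⇒== (Equivalence.from (Q∼L̃ u v) e)))
    ... | inj₂ ne = trans (≢⇒==-false ne) (sym (≢⇒==-false (ne ∘ Equivalence.to (Q∼L̃ u v))))

    same-cycle : ∀ a a′ (j : Fin (2 + len₋₂ (C a))) (j′ : Fin (2 + len₋₂ (C a′))) →
      cpart (C a) j ≡ cpart (C a′) j′ → a ≡ a′
    same-cycle a a′ j j′ e with toSum (a ≟ a′)
    ... | inj₁ a≡a′ = a≡a′
    ... | inj₂ a≢a′ = ⊥-elim (disjoint a a′ j j′ a≢a′ e)

    on-a-cycle? : ∀ i → (∃₂ λ a j → cpart (C a) j ≡ i) ⊎ (∀ a j → cpart (C a) j ≢ i)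
    on-a-cycle? i with search (λ a → anyFin (λ j → cpart (C a) j == i))
    ... | inj₁ (a , h) = let j , e = anyFin⇒∃ (λ j → cpart (C a) j == i) h in inj₁ (a , j , ==⇒≡ e)
    ... | inj₂ none =
      inj₂ (λ a j e → true≢false (trans (sym (∃⇒anyFin (λ j → cpart (C a) j == i) j (≡⇒== e))) (none a)))

    module OnCycle (a : Fin r) (j : Fin (2 + len₋₂ (C a))) where

      i i⁺ : Fin k
      i = cpart (C a) j
      i⁺ = cpart (C a) (cnext j)

      i⁺≢i : i⁺ ≢ i
      i⁺≢i e = cnext-≢ j (cpart-inj (C a) _ _ e)

      Hj : VSet (n G)
      Hj = H (B a) j

      Q-on-part : ∀ u → L u ≡ i → Q u ≡ (if Hj u then i⁺ else i)
      Q-on-part u Lu≡i with Hj u in Hju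
      ... | true = proj₁ (Q-spec u) a j Lu≡i Hju
      ... | false = trans (proj₂ (Q-spec u) not-moved) Lu≡i
        where
        not-moved : ∀ a′ j′ → ¬ ((L u ≡ cpart (C a′) j′) × (H (B a′) j′ u ≡ true))
        not-moved a′ j′ (Lu≡ , Hj′u) with same-cycle a′ a j′ j (trans (sym Lu≡) Lu≡i)
        ... | refl with cpart-inj (C a) j′ j (trans (sym Lu≡) Lu≡i)
        ...   | refl = true≢false (trans (sym Hj′u) Hju)

      same-L̃≡same-H : ∀ u v → L u ≡ i → L v ≡ i → (L̃ u == L̃ v) ≡ not (Hj u xor Hj v)
      same-L̃≡same-H u v Lu≡i Lv≡i =
        trans (same-L̃≡same-Q u v) (trans (cong₂ _==_ (Q-on-part u Lu≡i) (Q-on-part v Lv≡i)) (by-cases (Hj u) (Hj v)))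
        where
        by-cases : ∀ hu hv → ((if hu then i⁺ else i) == (if hv then i⁺ else i)) ≡ not (hu xor hv)
        by-cases true true = ==-refl i⁺
        by-cases false false = ==-refl i
        by-cases true false = ≢⇒==-false i⁺≢i
        by-cases false true = ≢⇒==-false (i⁺≢i ∘ sym)

      H⊆part : ∀ v → Hj v ≡ true → part L i v ≡ true
      H⊆part v h = ≡⇒== (H-sub (B a) j v h)

      cut≡crossing : ∀ u v → cut i u v ≡ Split.crossing (adj G) H⊆part u v
      cut≡crossing u v with part L i u in u∈i | part L i v in v∈i
      ... | false | _ = refl
      ... | true | false = refl
      ... | true | true rewrite same-L̃≡same-H u v (==⇒≡ u∈i) (==⇒≡ v∈i) | not-involutive (Hj u xor Hj v) = refl

      one-cut-edge : edgeCount (cut i) ≡ 1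
      one-cut-edge = trans (edgeCount-cong cut≡crossing)
        (Part.one-crossing-edge i Hj H⊆part (H-conn (B a) j) (R-conn (B a) j))

      part-changed : changed i ≡ true
      part-changed with isPartOf L i L̃ in e
      ... | false = refl
      ... | true with isPartOf⇒ L L̃ i e | proj₁ (H-conn (B a) j) | proj₁ (R-conn (B a) j)
      ...   | i′ , same | h , h∈H | s , s∈R = ⊥-elim (i⁺≢i (begin
        i⁺                          ≡⟨ cong (λ b → if b then i⁺ else i) h∈H ⟨
        (if Hj h then i⁺ else i)    ≡⟨ Q-on-part h (H-sub (B a) j h h∈H) ⟨
        Q h                         ≡⟨ Equivalence.from (Q∼L̃ h s) (trans (L̃≡i′ h (H⊆part h h∈H)) (sym (L̃≡i′ s (∧-elimˡ s∈R)))) ⟩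
        Q s                         ≡⟨ Q-on-part s (==⇒≡ (∧-elimˡ s∈R)) ⟩
        (if Hj s then i⁺ else i)    ≡⟨ cong (λ b → if b then i⁺ else i) (not-true (∧-elimʳ s∈R)) ⟩
        i                           ∎))
        where
        open ≡-Reasoning
        L̃≡i′ : ∀ v → part L i v ≡ true → L̃ v ≡ i′
        L̃≡i′ v v∈i = ==⇒≡ (trans (sym (same v)) v∈i)

    moved? : ∀ v → (∃₂ λ a j → (L v ≡ cpart (C a) j) × (H (B a) j v ≡ true)) ⊎ (Q v ≡ L v)
    moved? v with search (λ a → anyFin (λ j → (L v == cpart (C a) j) ∧ H (B a) j v))
    ... | inj₁ (a , h) = let j , Lv∧H = anyFin⇒∃ (λ j → (L v == cpart (C a) j) ∧ H (B a) j v) h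
                         in inj₁ (a , j , ==⇒≡ (∧-elimˡ Lv∧H) , ∧-elimʳ Lv∧H)
    ... | inj₂ none = inj₂ (proj₂ (Q-spec v) λ a j (Lv≡ , Hv) → true≢false
          (trans (sym (∃⇒anyFin (λ j → (L v == cpart (C a) j) ∧ H (B a) j v) j (∧-intro (≡⇒== Lv≡) Hv))) (none a)))

    module OffCycles (i : Fin k) (off : ∀ a j → cpart (C a) j ≢ i) where

      Q-on-part : ∀ u → L u ≡ i → Q u ≡ i
      Q-on-part u Lu≡i = trans (proj₂ (Q-spec u) (λ a j (Lu≡ , _) → off a j (trans (sym Lu≡) Lu≡i))) Lu≡i

      L̃-on-part : ∀ u v → L u ≡ i → L v ≡ i → L̃ u ≡ L̃ v
      L̃-on-part u v Lu≡i Lv≡i = Equivalence.to (Q∼L̃ u v) (trans (Q-on-part u Lu≡i) (sym (Q-on-part v Lv≡i)))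

      no-cut-edge : edgeCount (cut i) ≡ 0
      no-cut-edge = edgeCount-none (cut i) uncut
        where
        uncut : ∀ u v → cut i u v ≡ false
        uncut u v with part L i u in u∈i | part L i v in v∈i
        ... | false | _ = ∧-zeroʳ (adj G u v)
        ... | true | false = ∧-zeroʳ (adj G u v)
        ... | true | true rewrite ≡⇒== (L̃-on-part u v (==⇒≡ u∈i) (==⇒≡ v∈i)) = ∧-zeroʳ (adj G u v)

      part-unchanged : changed i ≡ false
      part-unchanged = cong not (isPartOf⇐ L L̃ i (L̃ v₀) same-part)
        where
        v₀ : V
        v₀ = proj₁ (nonempty i)
        same-part : ∀ v → (L v == i) ≡ (L̃ v == L̃ v₀)
        same-part v with toSum (L v ≟ i)
        ... | inj₁ Lv≡i = trans (≡⇒== Lv≡i) (sym (≡⇒== (L̃-on-part v v₀ Lv≡i (proj₂ (nonempty i)))))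
        ... | inj₂ Lv≢i = trans (≢⇒==-false Lv≢i) (sym (≢⇒==-false elsewhere))
          where
          Qv≡i : L̃ v ≡ L̃ v₀ → Q v ≡ i
          Qv≡i e = trans (Equivalence.from (Q∼L̃ v v₀) e) (Q-on-part v₀ (proj₂ (nonempty i)))
          elsewhere : L̃ v ≢ L̃ v₀
          elsewhere e with moved? v
          ... | inj₁ (a , j , Lv≡ , Hv) = off a (cnext j) (trans (sym (proj₁ (Q-spec v) a j Lv≡ Hv)) (Qv≡i e))
          ... | inj₂ Qv≡Lv = Lv≢i (trans (sym Qv≡Lv) (Qv≡i e))

    changed≡cut : ∀ i → indicator (changed i) ≡ edgeCount (cut i)
    changed≡cut i with on-a-cycle? i
    ... | inj₁ (a , j , refl) = trans (cong indicator (OnCycle.part-changed a j)) (sym (OnCycle.one-cut-edge a j))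
    ... | inj₂ off = trans (cong indicator (OffCycles.part-unchanged i off)) (sym (OffCycles.no-cut-edge i off))

    counts-agree : partsNotIn L L̃ ≡ edgesNotIn G T T̃
    counts-agree = trans partsNotIn≡ (trans (sum-cong-≗ changed≡cut) (sym edgesNotIn≡))

least-witness-below : (P : ℕ → Bool) → ∀ N →
  (∀ s → s < N → P s ≡ false) ⊎ (∃ λ m → (P m ≡ true) × (∀ s → s < m → P s ≡ false))
least-witness-below P zero = inj₁ (λ _ ())
least-witness-below P (suc N) with least-witness-below P N
... | inj₂ found = inj₂ found
... | inj₁ none with P N in PN
...   | true = inj₂ (N , PN , none)
...   | false = inj₁ below
  where
  below : ∀ s → s < suc N → P s ≡ false
  below s (s≤s s≤N) with ℕₚ.m≤n⇒m<n∨m≡n s≤N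
  ... | inj₁ s<N = none s s<N
  ... | inj₂ refl = PN

least-witness : (P : ℕ → Bool) → ∀ t → P t ≡ true → ∃ λ m → (P m ≡ true) × (∀ s → s < m → P s ≡ false)
least-witness P t Pt with least-witness-below P (suc t)
... | inj₁ none = ⊥-elim (true≢false (trans (sym Pt) (none t ≤-refl)))
... | inj₂ found = found

-- A bipartite graph between old parts i and new parts a (adjacency: meets i a) in which every changed
-- old part has exactly two neighbours and every neighbour of a changed part has exactly two changed
-- neighbours: its changed old parts are covered by disjoint cycles.
module TwoRegularBipartite {k : ℕ} (changed : Fin k → Bool) (meets : Fin k → Fin k → Bool)
  (first second : Fin k → Fin k)
  (first≢second : ∀ i → changed i ≡ true → first i ≢ second i)
  (meets⇒first∨second : ∀ i a → changed i ≡ true → meets i a ≡ true → a ≡ first i ⊎ a ≡ second i)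
  (meets-first : ∀ i → changed i ≡ true → meets i (first i) ≡ true)
  (meets-second : ∀ i → changed i ≡ true → meets i (second i) ≡ true)
  (partner : ∀ i a → changed i ≡ true → meets i a ≡ true → ∃ λ j → (changed j ≡ true) × (meets j a ≡ true) × (j ≢ i))
  (partner-unique : ∀ i j j′ a → changed i ≡ true → changed j ≡ true → changed j′ ≡ true →
                    meets i a ≡ true → meets j a ≡ true → meets j′ a ≡ true → j ≢ i → j′ ≢ i → j ≡ j′)
  where

  other-new : Fin k → Fin k → Fin k
  other-new i a = if a == first i then second i else first i

  other-new-spec : ∀ i a → changed i ≡ true → meets i a ≡ true →
    (meets i (other-new i a) ≡ true) × (other-new i a ≢ a) × (∀ b → meets i b ≡ true → b ≡ a ⊎ b ≡ other-new i a)
  other-new-spec i a ch meets-a with meets⇒first∨second i a ch meets-a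
  ... | inj₁ refl rewrite ==-refl (first i) =
    meets-second i ch , first≢second i ch ∘ sym , λ b meets-b → meets⇒first∨second i b ch meets-b
  ... | inj₂ refl rewrite ≢⇒==-false (first≢second i ch ∘ sym) =
    meets-first i ch , first≢second i ch , λ b meets-b → Data.Sum.swap (meets⇒first∨second i b ch meets-b)

  other-old : Fin k → Fin k → Fin k
  other-old a i with search (λ j → changed j ∧ (meets j a ∧ not (j == i)))
  ... | inj₁ (j , _) = j
  ... | inj₂ _ = i

  other-old-spec : ∀ a i → changed i ≡ true → meets i a ≡ true →
    (changed (other-old a i) ≡ true) × (meets (other-old a i) a ≡ true) × (other-old a i ≢ i)
  other-old-spec a i ch meets-a with search (λ j → changed j ∧ (meets j a ∧ not (j == i)))
  ... | inj₁ (j , h) =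
    ∧-elimˡ h , ∧-elimˡ (∧-elimʳ {changed j} h) , ==-false⇒≢ (not-true (∧-elimʳ (∧-elimʳ {changed j} h)))
  ... | inj₂ none with partner i a ch meets-a
  ...   | j , ch-j , meets-j , j≢i =
    ⊥-elim (true≢false (trans (sym (∧-intro ch-j (∧-intro meets-j (not-intro (≢⇒==-false j≢i))))) (none j)))

  other-old-unique : ∀ a i j → changed i ≡ true → meets i a ≡ true → changed j ≡ true → meets j a ≡ true → j ≢ i →
    j ≡ other-old a i
  other-old-unique a i j ch-i meets-i ch-j meets-j j≢i with other-old-spec a i ch-i meets-i
  ... | ch′ , meets′ , ≢′ = partner-unique i j (other-old a i) a ch-i ch-j ch′ meets-i meets-j meets′ j≢i ≢′

  record Cycle : Set where
    field
      len₋₂ : ℕ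
      old new : Fin (2 + len₋₂) → Fin k
      old-injective : ∀ x y → old x ≡ old y → x ≡ y
      old-changed : ∀ x → changed (old x) ≡ true
      meets-new : ∀ x → meets (old x) (new x) ≡ true
      next-meets-new : ∀ x → meets (old (cnext x)) (new x) ≡ true
      new-≢ : ∀ x → new (cnext x) ≢ new x
      closed : ∀ x j b → changed j ≡ true → meets (old x) b ≡ true → meets j b ≡ true → ∃ λ y → old y ≡ j

  module Orbit (i₀ : Fin k) (ch₀ : changed i₀ ≡ true) where

    a₀ b₀ : Fin k
    a₀ = first i₀
    b₀ = other-new i₀ a₀

    orbit : ℕ → Fin k × Fin k
    orbit zero = i₀ , a₀
    orbit (suc t) = let i , a = orbit t ; i′ = other-old a i in i′ , other-new i′ a

    I A : ℕ → Fin k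
    I t = proj₁ (orbit t)
    A t = proj₂ (orbit t)

    on-orbit : ∀ t → (changed (I t) ≡ true) × (meets (I t) (A t) ≡ true)
    on-orbit zero = ch₀ , meets-first i₀ ch₀
    on-orbit (suc t) with on-orbit t
    ... | ch , meets-A with other-old-spec (A t) (I t) ch meets-A
    ...   | ch′ , meets′ , _ = ch′ , proj₁ (other-new-spec (I (suc t)) (A t) ch′ meets′)

    next-old : ∀ t → (I (suc t) ≢ I t) × (changed (I (suc t)) ≡ true) × (meets (I (suc t)) (A t) ≡ true)
    next-old t with on-orbit t
    ... | ch , meets-A with other-old-spec (A t) (I t) ch meets-A
    ...   | ch′ , meets′ , ≢′ = ≢′ , ch′ , meets′

    next-new : ∀ t → (A (suc t) ≢ A t) × (∀ b → meets (I (suc t)) b ≡ true → b ≡ A t ⊎ b ≡ A (suc t))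
    next-new t with next-old t
    ... | _ , ch′ , meets′ with other-new-spec (I (suc t)) (A t) ch′ meets′
    ...   | _ , ≢′ , only = ≢′ , only

    olds-of-A : ∀ t j → changed j ≡ true → meets j (A t) ≡ true → j ≡ I t ⊎ j ≡ I (suc t)
    olds-of-A t j ch-j meets-j with toSum (j ≟ I t)
    ... | inj₁ j≡I = inj₁ j≡I
    ... | inj₂ j≢I = inj₂ (other-old-unique (A t) (I t) j (proj₁ (on-orbit t)) (proj₂ (on-orbit t)) ch-j meets-j j≢I)

    news-of-i₀ : ∀ b → meets i₀ b ≡ true → b ≡ a₀ ⊎ b ≡ b₀
    news-of-i₀ = proj₂ (proj₂ (other-new-spec i₀ a₀ ch₀ (meets-first i₀ ch₀)))

    b₀≢a₀ : b₀ ≢ a₀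
    b₀≢a₀ = proj₁ (proj₂ (other-new-spec i₀ a₀ ch₀ (meets-first i₀ ch₀)))

    Distinct : ℕ → Set
    Distinct t = ∀ s s′ → s ≤ t → s′ ≤ t → I s ≡ I s′ → s ≡ s′

    -- I (t+1) meets A t, so A t is A (s-1) or A s; every choice but s = 0, A t = b₀ repeats an I.
    first-return : ∀ t → Distinct t → ∀ s → s ≤ t → I (suc t) ≡ I s → (s ≡ 0) × (A t ≡ b₀)
    first-return t D (suc s) s<t e
      with proj₂ (next-new s) (A t) (subst (λ z → meets z (A t) ≡ true) e (proj₂ (proj₂ (next-old t))))
    ... | inj₁ At≡As with olds-of-A s (I t) (proj₁ (on-orbit t)) (subst (λ z → meets (I t) z ≡ true) At≡As (proj₂ (on-orbit t)))
    ...   | inj₁ It≡Is = ⊥-elim (<-irrefl (sym (D t s ≤-refl (≤-trans (ℕₚ.n≤1+n s) s<t) It≡Is)) s<t)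
    ...   | inj₂ It≡Is+1 with D t (suc s) ≤-refl s<t It≡Is+1
    ...     | refl = ⊥-elim (proj₁ (next-old t) (trans e (sym It≡Is+1)))
    first-return t D (suc s) s<t e | inj₂ At≡As+1
      with olds-of-A (suc s) (I t) (proj₁ (on-orbit t)) (subst (λ z → meets (I t) z ≡ true) At≡As+1 (proj₂ (on-orbit t)))
    ... | inj₁ It≡Is+1 with D t (suc s) ≤-refl s<t It≡Is+1
    ...   | refl = ⊥-elim (proj₁ (next-old t) (trans e (sym It≡Is+1)))
    first-return t D (suc s) s<t e | inj₂ At≡As+1 | inj₂ It≡Is+2 with ℕₚ.m≤n⇒m<n∨m≡n s<t
    ... | inj₂ refl = ⊥-elim (proj₁ (next-old (suc s)) (sym It≡Is+2))
    ... | inj₁ s+1<t with D t (suc (suc s)) ≤-refl s+1<t It≡Is+2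
    ...   | refl = ⊥-elim (proj₁ (next-new (suc s)) At≡As+1)
    first-return t D zero _ e with news-of-i₀ (A t) (subst (λ z → meets z (A t) ≡ true) e (proj₂ (proj₂ (next-old t))))
    ... | inj₂ At≡b₀ = refl , At≡b₀
    ... | inj₁ At≡a₀ with olds-of-A 0 (I t) (proj₁ (on-orbit t)) (subst (λ z → meets (I t) z ≡ true) At≡a₀ (proj₂ (on-orbit t)))
    ...   | inj₁ It≡I₀ with D t 0 ≤-refl z≤n It≡I₀
    ...     | refl = ⊥-elim (proj₁ (next-old 0) e)
    first-return zero D zero _ e | inj₁ _ | inj₂ I₀≡I₁ = ⊥-elim (proj₁ (next-old 0) (sym I₀≡I₁))
    first-return (suc t) D zero _ e | inj₁ At≡a₀ | inj₂ It≡I₁ with D (suc t) 1 ≤-refl (s≤s z≤n) It≡I₁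
    ... | refl = ⊥-elim (proj₁ (next-new 0) At≡a₀)

    returns-at : ℕ → Bool
    returns-at t = anyFin (λ (x : Fin (suc t)) → I (suc t) == I (toℕ x))

    returns-at⇒ : ∀ t → returns-at t ≡ true → ∃ λ s → (s ≤ t) × (I (suc t) ≡ I s)
    returns-at⇒ t h with anyFin⇒∃ (λ (x : Fin (suc t)) → I (suc t) == I (toℕ x)) h
    ... | x , e = toℕ x , ℕₚ.≤-pred (Finₚ.toℕ<n x) , ==⇒≡ e

    returns-at⇐ : ∀ t s → s ≤ t → I (suc t) ≡ I s → returns-at t ≡ true
    returns-at⇐ t s s≤t e = ∃⇒anyFin (λ (x : Fin (suc t)) → I (suc t) == I (toℕ x)) (Data.Fin.fromℕ< (s≤s s≤t))
      (≡⇒== (trans e (cong I (sym (Finₚ.toℕ-fromℕ< (s≤s s≤t))))))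

    eventually-returns : ∃ λ t → returns-at t ≡ true
    eventually-returns with Finₚ.pigeonhole (≤-refl {suc k}) (λ (x : Fin (suc k)) → I (toℕ x))
    ... | x , y , x<y , e with toℕ y in ey
    ...   | suc t = t , returns-at⇐ t (toℕ x) (ℕₚ.≤-pred x<y) (sym e)
    ...   | zero = ⊥-elim (ℕₚ.n≮0 x<y)

    opaque
      first-return-time : ∃ λ m → (returns-at m ≡ true) × (∀ s → s < m → returns-at s ≡ false)
      first-return-time = least-witness returns-at (proj₁ eventually-returns) (proj₂ eventually-returns)

    m : ℕ
    m = proj₁ first-return-time

    no-return-before : ∀ a b → a < b → b ≤ m → I b ≢ I a
    no-return-before a (suc b) (s≤s a≤b) b<m e =
      true≢false (trans (sym (returns-at⇐ b a a≤b e)) (proj₂ (proj₂ first-return-time) b b<m))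

    distinct-before-return : Distinct m
    distinct-before-return s s′ s≤m s′≤m e with <-cmp s s′
    ... | tri≈ _ s≡s′ _ = s≡s′
    ... | tri< s<s′ _ _ = ⊥-elim (no-return-before s s′ s<s′ s′≤m (sym e))
    ... | tri> _ _ s′<s = ⊥-elim (no-return-before s′ s s′<s s≤m e)

    returns-to-start : (I (suc m) ≡ i₀) × (A m ≡ b₀)
    returns-to-start with returns-at⇒ m (proj₁ (proj₂ first-return-time))
    ... | s , s≤m , e with first-return m distinct-before-return s s≤m e
    ...   | refl , Am≡b₀ = e , Am≡b₀

    m≡1+ : ∃ λ m′ → m ≡ suc m′
    m≡1+ with m in e
    ... | suc m′ = m′ , refl
    ... | zero = ⊥-elim (proj₁ (next-old 0) (subst (λ z → I (suc z) ≡ i₀) e (proj₁ returns-to-start)))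

    closed-orbit : ∀ s → s ≤ m → ∀ j b → changed j ≡ true → meets (I s) b ≡ true → meets j b ≡ true →
      ∃ λ s′ → (s′ ≤ m) × (I s′ ≡ j)
    closed-orbit (suc s) s≤m j b ch-j meets-s meets-j with proj₂ (next-new s) b meets-s
    ... | inj₁ b≡As with olds-of-A s j ch-j (subst (λ z → meets j z ≡ true) b≡As meets-j)
    ...   | inj₁ j≡Is = s , ≤-trans (ℕₚ.n≤1+n s) s≤m , sym j≡Is
    ...   | inj₂ j≡Is+1 = suc s , s≤m , sym j≡Is+1
    closed-orbit (suc s) s≤m j b ch-j meets-s meets-j | inj₂ b≡As+1
      with olds-of-A (suc s) j ch-j (subst (λ z → meets j z ≡ true) b≡As+1 meets-j)
    ... | inj₁ j≡Is+1 = suc s , s≤m , sym j≡Is+1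
    ... | inj₂ j≡Is+2 with ℕₚ.m≤n⇒m<n∨m≡n s≤m
    ...   | inj₁ s+1<m = suc (suc s) , s+1<m , sym j≡Is+2
    ...   | inj₂ s+1≡m =
      0 , z≤n , trans (sym (proj₁ returns-to-start)) (trans (cong (λ z → I (suc z)) (sym s+1≡m)) (sym j≡Is+2))
    closed-orbit zero _ j b ch-j meets-s meets-j with news-of-i₀ b meets-s
    ... | inj₁ b≡a₀ with olds-of-A 0 j ch-j (subst (λ z → meets j z ≡ true) b≡a₀ meets-j)
    ...   | inj₁ j≡I₀ = 0 , z≤n , sym j≡I₀
    ...   | inj₂ j≡I₁ = 1 , subst (1 ≤_) (sym (proj₂ m≡1+)) (s≤s z≤n) , sym j≡I₁
    closed-orbit zero _ j b ch-j meets-s meets-j | inj₂ b≡b₀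
      with olds-of-A m j ch-j (subst (λ z → meets j z ≡ true) (trans b≡b₀ (sym (proj₂ returns-to-start))) meets-j)
    ... | inj₁ j≡Im = m , ≤-refl , sym j≡Im
    ... | inj₂ j≡Im+1 = 0 , z≤n , trans (sym (proj₁ returns-to-start)) (sym j≡Im+1)

    cycle : Cycle
    cycle = record
      { len₋₂ = m′
      ; old = I ∘ toℕ
      ; new = A ∘ toℕ
      ; old-injective = λ x y e → Finₚ.toℕ-injective (distinct-before-return (toℕ x) (toℕ y) (≤m x) (≤m y) e)
      ; old-changed = λ x → proj₁ (on-orbit (toℕ x))
      ; meets-new = λ x → proj₂ (on-orbit (toℕ x))
      ; next-meets-new = next-meets-new
      ; new-≢ = new-≢
      ; closed = closed
      }
      where
      m′ : ℕ
      m′ = proj₁ m≡1+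
      ≤m : (x : Fin (2 + m′)) → toℕ x ≤ m
      ≤m x = subst (toℕ x ≤_) (sym (proj₂ m≡1+)) (ℕₚ.≤-pred (Finₚ.toℕ<n x))
      wraps : ∀ x → toℕ x ≡ suc m′ → m ≡ toℕ x
      wraps x last = trans (proj₂ m≡1+) (sym last)
      next-meets-new : ∀ x → meets (I (toℕ (cnext x))) (A (toℕ x)) ≡ true
      next-meets-new x with cnext-cases x
      ... | inj₁ (_ , next) = subst (λ z → meets (I z) (A (toℕ x)) ≡ true) (sym next) (proj₂ (proj₂ (next-old (toℕ x))))
      ... | inj₂ (last , next) = subst (λ z → meets (I z) (A (toℕ x)) ≡ true) (sym next)
              (subst (λ z → meets i₀ (A z) ≡ true) (wraps x last)
                (subst (λ z → meets z (A m) ≡ true) (proj₁ returns-to-start) (proj₂ (proj₂ (next-old m)))))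
      new-≢ : ∀ x → A (toℕ (cnext x)) ≢ A (toℕ x)
      new-≢ x e with cnext-cases x
      ... | inj₁ (_ , next) = proj₁ (next-new (toℕ x)) (trans (cong A (sym next)) e)
      ... | inj₂ (last , next) =
        b₀≢a₀ (sym (trans (trans (cong A (sym next)) e) (trans (cong A (sym (wraps x last))) (proj₂ returns-to-start))))
      closed : ∀ x j b → changed j ≡ true → meets (I (toℕ x)) b ≡ true → meets j b ≡ true → ∃ λ y → I (toℕ y) ≡ j
      closed x j b ch-j meets-x meets-j with closed-orbit (toℕ x) (≤m x) j b ch-j meets-x meets-j
      ... | s , s≤m , e = Data.Fin.fromℕ< s<2+m′ , trans (cong I (Finₚ.toℕ-fromℕ< s<2+m′)) e
        where
        s<2+m′ : s < 2 + m′
        s<2+m′ = s≤s (subst (s ≤_) (proj₂ m≡1+) s≤m)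

    stays-in : (D : Fin k → Bool) → D i₀ ≡ true →
      (∀ i j b → D i ≡ true → changed j ≡ true → meets i b ≡ true → meets j b ≡ true → D j ≡ true) →
      ∀ s → D (I s) ≡ true
    stays-in D D₀ closed zero = D₀
    stays-in D D₀ closed (suc s) =
      closed (I s) (I (suc s)) (A s) (stays-in D D₀ closed s)
             (proj₁ (proj₂ (next-old s))) (proj₂ (on-orbit s)) (proj₂ (proj₂ (next-old s)))

  Closed : (Fin k → Bool) → Set
  Closed D = ∀ i j b → D i ≡ true → changed j ≡ true → meets i b ≡ true → meets j b ≡ true → D j ≡ true

  record CycleCover (D : Fin k → Bool) : Set where
    field
      r : ℕ
      cycles : Fin r → Cycle
      inside : ∀ a x → D (Cycle.old (cycles a) x) ≡ true
      disjoint : ∀ a b x y → a ≢ b → Cycle.old (cycles a) x ≢ Cycle.old (cycles b) y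
      covers : ∀ i → D i ≡ true → ∃₂ λ a x → Cycle.old (cycles a) x ≡ i

  module WithoutCycle (D : Fin k → Bool) (D-closed : Closed D) (D⊆changed : ∀ i → D i ≡ true → changed i ≡ true)
    (C : Cycle) (C⊆D : ∀ x → D (Cycle.old C x) ≡ true) where

    on-C : Fin k → Bool
    on-C i = anyFin (λ x → Cycle.old C x == i)

    on-C⇒ : ∀ i → on-C i ≡ true → ∃ λ x → Cycle.old C x ≡ i
    on-C⇒ i h = let x , e = anyFin⇒∃ (λ x → Cycle.old C x == i) h in x , ==⇒≡ e

    on-C⇐ : ∀ x → on-C (Cycle.old C x) ≡ true
    on-C⇐ x = ∃⇒anyFin (λ y → Cycle.old C y == Cycle.old C x) x (==-refl _)

    D′ : Fin k → Bool
    D′ i = D i ∧ not (on-C i)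

    D′-closed : Closed D′
    D′-closed i j b D′i ch-j meets-i meets-j = ∧-intro (D-closed i j b (∧-elimˡ D′i) ch-j meets-i meets-j) (not-intro j∉C)
      where
      j∉C : on-C j ≡ false
      j∉C = ¬-not λ j∈C →
        let x , e = on-C⇒ j j∈C
            y , e′ = Cycle.closed C x i b (D⊆changed i (∧-elimˡ D′i)) (subst (λ z → meets z b ≡ true) (sym e) meets-j) meets-i
        in true≢false (trans (sym (trans (cong on-C (sym e′)) (on-C⇐ y))) (not-true (∧-elimʳ {D i} D′i)))

    D′-smaller : count D′ < count D
    D′-smaller = count-mono-< (λ i → ∧-elimˡ) (Cycle.old C zero)
      (trans (cong (λ z → D (Cycle.old C zero) ∧ not z) (on-C⇐ zero)) (∧-zeroʳ _)) (C⊆D zero)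

    add-cycle : CycleCover D′ → CycleCover D
    add-cycle cover = record
      { r = suc r
      ; cycles = cycles′
      ; inside = inside′
      ; disjoint = disjoint′
      ; covers = covers′
      }
      where
      open CycleCover cover
      cycles′ : Fin (suc r) → Cycle
      cycles′ zero = C
      cycles′ (suc a) = cycles a
      inside′ : ∀ a x → D (Cycle.old (cycles′ a) x) ≡ true
      inside′ zero = C⊆D
      inside′ (suc a) x = ∧-elimˡ (inside a x)
      off-C : ∀ a y → on-C (Cycle.old (cycles a) y) ≡ false
      off-C a y = not-true (∧-elimʳ {D _} (inside a y))
      disjoint′ : ∀ a b x y → a ≢ b → Cycle.old (cycles′ a) x ≢ Cycle.old (cycles′ b) y
      disjoint′ zero zero x y a≢b _ = a≢b refl
      disjoint′ zero (suc b) x y _ e = true≢false (trans (sym (on-C⇐ x)) (trans (cong on-C e) (off-C b y)))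
      disjoint′ (suc a) zero x y _ e = true≢false (trans (sym (on-C⇐ y)) (trans (cong on-C (sym e)) (off-C a x)))
      disjoint′ (suc a) (suc b) x y a≢b = disjoint a b x y (a≢b ∘ cong suc)
      covers′ : ∀ i → D i ≡ true → ∃₂ λ a x → Cycle.old (cycles′ a) x ≡ i
      covers′ i Di with on-C i in i∈C
      ... | true = let x , e = on-C⇒ i i∈C in zero , x , e
      ... | false = let a , x , e = covers i (∧-intro Di (not-intro i∈C)) in suc a , x , e

  cycle-cover : ∀ fuel (D : Fin k → Bool) → count D ≤ fuel →
    (∀ i → D i ≡ true → changed i ≡ true) → Closed D → CycleCover D
  cycle-cover fuel D small D⊆changed D-closed with search D
  ... | inj₂ empty = record
    { r = 0 ; cycles = λ () ; inside = λ () ; disjoint = λ ()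
    ; covers = λ i Di → ⊥-elim (true≢false (trans (sym Di) (empty i))) }
  cycle-cover zero D small D⊆changed D-closed | inj₁ (i₀ , D₀) =
    ⊥-elim (<-irrefl refl (≤-trans (∃⇒count-pos D i₀ D₀) small))
  cycle-cover (suc fuel) D small D⊆changed D-closed | inj₁ (i₀ , D₀) =
    add-cycle (cycle-cover fuel D′ (ℕₚ.≤-pred (<-≤-trans D′-smaller small)) (λ i → D⊆changed i ∘ ∧-elimˡ) D′-closed)
    where
    open Orbit i₀ (D⊆changed i₀ D₀)
    open WithoutCycle D D-closed D⊆changed cycle (λ x → stays-in D D₀ D-closed (toℕ x))

module ToBUD (G : Graph) {k : ℕ} (L L̃ : Fin (n G) → Fin k) {T T̃ : Fin k → ESet (n G)}
  (T-unique : ∀ i → IsUniqueSpanningTree G (part L i) (T i))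
  (T̃-unique : ∀ i → IsUniqueSpanningTree G (part L̃ i) (T̃ i))
  (L-connected : ∀ i → InducesConnected G (part L i))
  (L̃-connected : ∀ a → InducesConnected G (part L̃ a))
  (p : Fin (n G) → ℚ) (positive : ∀ v → 0ℚ <ℚ p v)
  (L-balanced : ∀ i j → popSum p (part L i) ≡ popSum p (part L j))
  (L̃-balanced : ∀ i j → popSum p (part L̃ i) ≡ popSum p (part L̃ j))
  (counts-agree : partsNotIn L L̃ ≡ edgesNotIn G T T̃) where

  open Comparison G L L̃ T-unique T̃-unique
  open Population p positive

  v₀ : Fin k → V
  v₀ i = proj₁ (proj₁ (L-connected i))

  L-v₀ : ∀ i → L (v₀ i) ≡ i
  L-v₀ i = ==⇒≡ (proj₂ (proj₁ (L-connected i)))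

  inside-new-part⇒unchanged : ∀ i a → (∀ v → L v ≡ i → L̃ v ≡ a) → changed i ≡ false
  inside-new-part⇒unchanged i a ⊆ = cong not (isPartOf⇐ L L̃ i a same)
    where
    ⊇ : ∀ v → L̃ v ≡ a → L v ≡ i
    ⊇ = equal-population-⊆⇒⊇ L L̃ i a (balanced-populations-agree L L̃ L-balanced L̃-balanced i a) ⊆
    same : ∀ v → (L v == i) ≡ (L̃ v == a)
    same v with toSum (L v ≟ i)
    ... | inj₁ Lv≡i = trans (≡⇒== Lv≡i) (sym (≡⇒== (⊆ v Lv≡i)))
    ... | inj₂ Lv≢i = trans (≢⇒==-false Lv≢i) (sym (≢⇒==-false (Lv≢i ∘ ⊇ v)))

  changed⇒cut : ∀ i → changed i ≡ true → 1 ≤ edgeCount (cut i)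
  changed⇒cut i ch with search (λ v → part L i v ∧ not (L̃ v == L̃ (v₀ i)))
  ... | inj₁ (v , h) = Part.Colouring.bichromatic-pos i L̃ (v₀ i) v (proj₂ (proj₁ (L-connected i))) (∧-elimˡ h)
                         (==-false⇒≢ (not-true (∧-elimʳ {part L i v} h)) ∘ sym)
  ... | inj₂ none = ⊥-elim (true≢false (trans (sym ch) (inside-new-part⇒unchanged i (L̃ (v₀ i)) ⊆)))
    where
    ⊆ : ∀ v → L v ≡ i → L̃ v ≡ L̃ (v₀ i)
    ⊆ v Lv≡i = ==⇒≡ (not-false (trans (sym (cong (λ b → b ∧ not (L̃ v == L̃ (v₀ i))) (≡⇒== Lv≡i))) (none v)))

  indicator≤cut : ∀ i → indicator (changed i) ≤ edgeCount (cut i)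
  indicator≤cut i with changed i in ch
  ... | true = changed⇒cut i ch
  ... | false = z≤n

  -- Every changed part is cut at least once, and the totals agree.
  changed≡cut : ∀ i → indicator (changed i) ≡ edgeCount (cut i)
  changed≡cut = sum-mono-≤-equality indicator≤cut (trans (sym partsNotIn≡) (trans counts-agree edgesNotIn≡))

  one-cut-edge : ∀ i → changed i ≡ true → edgeCount (cut i) ≡ 1
  one-cut-edge i ch = trans (sym (changed≡cut i)) (cong indicator ch)

  ends : Fin k → V × V
  ends i with search (λ x → anyFin (cut i x))
  ... | inj₁ (x , h) = x , proj₁ (anyFin⇒∃ (cut i x) h)
  ... | inj₂ _ = v₀ i , v₀ i

  ends-cut : ∀ i → changed i ≡ true → cut i (proj₁ (ends i)) (proj₂ (ends i)) ≡ true
  ends-cut i ch with search (λ x → anyFin (cut i x))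
  ... | inj₁ (x , h) = proj₂ (anyFin⇒∃ (cut i x) h)
  ... | inj₂ none with edgeCount-pos⇒∃ (cut i) (ℕₚ.≤-reflexive (sym (one-cut-edge i ch)))
  ...   | x , y , h = ⊥-elim (true≢false (trans (sym (∃⇒anyFin (cut i x) y h)) (none x)))

  module Cut (i : Fin k) (ch : changed i ≡ true) =
    Part.Colouring.OneBichromaticEdge i L̃ (one-cut-edge i ch) (ends-cut i ch)
  module Cut′ (i : Fin k) (ch : changed i ≡ true) =
    Part.Colouring.OneBichromaticEdge i L̃ (one-cut-edge i ch)
      (trans (Part.Colouring.bichromatic-sym i L̃ (proj₂ (ends i)) (proj₁ (ends i))) (ends-cut i ch))

  first second : Fin k → Fin k
  first i = L̃ (proj₁ (ends i))
  second i = L̃ (proj₂ (ends i))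

  meets : Fin k → Fin k → Bool
  meets i a = anyFin (λ v → (L v == i) ∧ (L̃ v == a))

  meets⇒ : ∀ i a → meets i a ≡ true → ∃ λ v → (L v ≡ i) × (L̃ v ≡ a)
  meets⇒ i a h with anyFin⇒∃ (λ v → (L v == i) ∧ (L̃ v == a)) h
  ... | v , both = v , ==⇒≡ (∧-elimˡ both) , ==⇒≡ (∧-elimʳ {L v == i} both)

  meets⇐ : ∀ {i a} v → L v ≡ i → L̃ v ≡ a → meets i a ≡ true
  meets⇐ {i} {a} v Lv≡i L̃v≡a = ∃⇒anyFin (λ v → (L v == i) ∧ (L̃ v == a)) v (∧-intro (≡⇒== Lv≡i) (≡⇒== L̃v≡a))

  first≢second : ∀ i → changed i ≡ true → first i ≢ second i
  first≢second i ch = Cut.Lx≢Ly i ch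

  meets⇒first∨second : ∀ i a → changed i ≡ true → meets i a ≡ true → a ≡ first i ⊎ a ≡ second i
  meets⇒first∨second i a ch h with meets⇒ i a h
  ... | v , Lv≡i , L̃v≡a = Data.Sum.map (trans (sym L̃v≡a)) (trans (sym L̃v≡a)) (Cut.two-colours i ch v (≡⇒== Lv≡i))

  meets-first : ∀ i → changed i ≡ true → meets i (first i) ≡ true
  meets-first i ch = meets⇐ (proj₁ (ends i)) (==⇒≡ (Cut.x∈S i ch)) refl

  meets-second : ∀ i → changed i ≡ true → meets i (second i) ≡ true
  meets-second i ch = meets⇐ (proj₂ (ends i)) (==⇒≡ (Cut′.x∈S i ch)) refl

  piece-connected : ∀ i a → changed i ≡ true → meets i a ≡ true → InducesConnected G (λ v → (L v == i) ∧ (L̃ v == a))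
  piece-connected i a ch h with meets⇒first∨second i a ch h
  ... | inj₁ refl = Cut.C-connected i ch
  ... | inj₂ refl = Cut′.C-connected i ch

  image : Fin k → Fin k
  image i = L̃ (v₀ i)

  unchanged⇒same : ∀ i → changed i ≡ false → ∀ v → (L v == i) ≡ (L̃ v == image i)
  unchanged⇒same i unch v with isPartOf⇒ L L̃ i (not-false unch)
  ... | a , same = trans (same v) (cong (L̃ v ==_) (sym (==⇒≡ (trans (sym (same (v₀ i))) (≡⇒== (L-v₀ i))))))

  unchanged-⊆ : ∀ i → changed i ≡ false → ∀ v → L v ≡ i → L̃ v ≡ image i
  unchanged-⊆ i unch v Lv≡i = ==⇒≡ (trans (sym (unchanged⇒same i unch v)) (≡⇒== Lv≡i))

  unchanged-⊇ : ∀ i → changed i ≡ false → ∀ v → L̃ v ≡ image i → L v ≡ i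
  unchanged-⊇ i unch v L̃v≡ = ==⇒≡ (trans (unchanged⇒same i unch v) (≡⇒== L̃v≡))

  -- An unchanged old part is a new part, which then meets no other old part.
  meets-changed : ∀ i j a → changed i ≡ true → meets i a ≡ true → meets j a ≡ true → changed j ≡ true
  meets-changed i j a ch-i meets-i meets-j with changed j in ch-j
  ... | true = refl
  ... | false with meets⇒ j a meets-j | meets⇒ i a meets-i
  ...   | w , Lw≡j , L̃w≡a | v , Lv≡i , L̃v≡a = ⊥-elim (true≢false (trans (sym ch-i) (trans (cong changed i≡j) ch-j)))
    where
    i≡j : i ≡ j
    i≡j = trans (sym Lv≡i) (unchanged-⊇ j ch-j v (trans L̃v≡a (trans (sym L̃w≡a) (unchanged-⊆ j ch-j w Lw≡j))))

  -- Otherwise the new part a would lie inside old part i, hence equal it, yet part i meets two new parts.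
  partner : ∀ i a → changed i ≡ true → meets i a ≡ true → ∃ λ j → (changed j ≡ true) × (meets j a ≡ true) × (j ≢ i)
  partner i a ch meets-a with search (λ j → changed j ∧ (meets j a ∧ not (j == i)))
  ... | inj₁ (j , h) =
    j , ∧-elimˡ h , ∧-elimˡ (∧-elimʳ {changed j} h) , ==-false⇒≢ (not-true (∧-elimʳ (∧-elimʳ {changed j} h)))
  ... | inj₂ none =
    ⊥-elim (first≢second i ch (trans (⊇ _ (==⇒≡ (Cut.x∈S i ch))) (sym (⊇ _ (==⇒≡ (Cut′.x∈S i ch))))))
    where
    ⊆ : ∀ v → L̃ v ≡ a → L v ≡ i
    ⊆ v L̃v≡a with toSum (L v ≟ i)
    ... | inj₁ Lv≡i = Lv≡i
    ... | inj₂ Lv≢i = ⊥-elim (true≢false (trans (sym (∧-intro (meets-changed i (L v) a ch meets-a meets-v)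
                                                  (∧-intro meets-v (not-intro (≢⇒==-false Lv≢i))))) (none (L v))))
      where
      meets-v : meets (L v) a ≡ true
      meets-v = meets⇐ v refl L̃v≡a
    ⊇ : ∀ v → L v ≡ i → L̃ v ≡ a
    ⊇ = equal-population-⊆⇒⊇ L̃ L a i (sym (balanced-populations-agree L L̃ L-balanced L̃-balanced i a)) ⊆

  degree : Bool → ℕ
  degree c = suc (indicator c)

  meets-of-changed : ∀ i → changed i ≡ true → ∀ a → meets i a ≡ ((a == first i) ∨ (a == second i))
  meets-of-changed i ch a with meets i a in h
  ... | true with meets⇒first∨second i a ch h
  ...   | inj₁ refl = sym (∨-introˡ _ (==-refl (first i)))
  ...   | inj₂ refl = sym (∨-introʳ (second i == first i) (==-refl (second i)))
  meets-of-changed i ch a | false with toSum (a ≟ first i) | toSum (a ≟ second i)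
  ... | inj₁ refl | _ = ⊥-elim (true≢false (trans (sym (meets-first i ch)) h))
  ... | inj₂ _ | inj₁ refl = ⊥-elim (true≢false (trans (sym (meets-second i ch)) h))
  ... | inj₂ a≢first | inj₂ a≢second rewrite ≢⇒==-false a≢first | ≢⇒==-false a≢second = refl

  meets-of-unchanged : ∀ i → changed i ≡ false → ∀ a → meets i a ≡ (a == image i)
  meets-of-unchanged i unch a with meets i a in h
  ... | true with meets⇒ i a h
  ...   | v , Lv≡i , L̃v≡a = sym (≡⇒== (trans (sym L̃v≡a) (unchanged-⊆ i unch v Lv≡i)))
  meets-of-unchanged i unch a | false with toSum (a ≟ image i)
  ... | inj₁ refl = ⊥-elim (true≢false (trans (sym (meets⇐ (v₀ i) (L-v₀ i) refl)) h))
  ... | inj₂ a≢image = sym (≢⇒==-false a≢image)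

  old-degree : ∀ i → count (meets i) ≡ degree (changed i)
  old-degree i with changed i in ch
  ... | true = begin
    count (meets i)                                 ≡⟨ count-cong (meets-of-changed i ch) ⟩
    count (λ a → (a == first i) ∨ (a == second i))  ≡⟨ count-insert (first i) (_== second i) (≢⇒==-false (first≢second i ch)) ⟩
    suc (count (_== second i))                      ≡⟨ cong suc (count-single (second i)) ⟩
    2                                               ∎
    where open ≡-Reasoning
  ... | false = trans (count-cong (meets-of-unchanged i ch)) (count-single (image i))

  touches-changed : Fin k → Bool
  touches-changed a = anyFin (λ i → changed i ∧ meets i a)

  w₀ : Fin k → V
  w₀ a = proj₁ (proj₁ (L̃-connected a))

  L̃-w₀ : ∀ a → L̃ (w₀ a) ≡ a
  L̃-w₀ a = ==⇒≡ (proj₂ (proj₁ (L̃-connected a)))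

  meets-w₀ : ∀ a → meets (L (w₀ a)) a ≡ true
  meets-w₀ a = meets⇐ (w₀ a) refl (L̃-w₀ a)

  new-degree-≥ : ∀ a → degree (touches-changed a) ≤ count (λ i → meets i a)
  new-degree-≥ a with touches-changed a in t
  ... | false = ∃⇒count-pos (λ i → meets i a) (L (w₀ a)) (meets-w₀ a)
  ... | true with anyFin⇒∃ (λ i → changed i ∧ meets i a) t
  ...   | i , ch∧meets with partner i a (∧-elimˡ ch∧meets) (∧-elimʳ {changed i} ch∧meets)
  ...     | j , _ , meets-j , j≢i = count≥2 (λ i → meets i a) i j (j≢i ∘ sym) (∧-elimʳ {changed i} ch∧meets) meets-j

  -- Each untouched new part contains an unchanged old part, which meets no other new part.
  untouched≤unchanged : count (not ∘ touches-changed) ≤ count (not ∘ changed)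
  untouched≤unchanged = begin
    sum (λ a → indicator (not (touches-changed a)))         ≤⟨ sum-mono-≤ witness ⟩
    sum (λ a → count (λ j → meets j a ∧ not (changed j)))
      ≡⟨ ∑-comm (λ a j → indicator (meets j a ∧ not (changed j))) ⟩
    sum (λ j → count (λ a → meets j a ∧ not (changed j)))   ≡⟨ sum-cong-≗ unchanged-meets-one ⟩
    sum (λ j → indicator (not (changed j)))                 ∎
    where
    open ℕₚ.≤-Reasoning
    witness : ∀ a → indicator (not (touches-changed a)) ≤ count (λ j → meets j a ∧ not (changed j))
    witness a with touches-changed a in t
    ... | true = z≤n
    ... | false = ∃⇒count-pos _ (L (w₀ a)) (∧-intro (meets-w₀ a) (not-intro (¬-not untouched)))
      where
      untouched : changed (L (w₀ a)) ≢ true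
      untouched ch = true≢false (trans (sym (∃⇒anyFin (λ i → changed i ∧ meets i a) (L (w₀ a)) (∧-intro ch (meets-w₀ a)))) t)
    unchanged-meets-one : ∀ j → count (λ a → meets j a ∧ not (changed j)) ≡ indicator (not (changed j))
    unchanged-meets-one j with changed j in ch
    ... | true = count-none _ (λ a → ∧-zeroʳ (meets j a))
    ... | false = trans (count-cong (λ a → ∧-comm (meets j a) true)) (trans (old-degree j) (cong degree ch))

  -- Double counting: there are Σᵢ degree (changed i) = 2k − #unchanged ≤ 2k − #untouched incidences.
  incidences≤ : sum (λ a → count (λ i → meets i a)) ≤ sum (λ a → degree (touches-changed a))
  incidences≤ = ℕₚ.+-cancelʳ-≤ _ _ _ (begin
    sum (λ a → count (λ i → meets i a)) + count (not ∘ changed)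
      ≡⟨ cong (_+ count (not ∘ changed)) (∑-comm (λ a i → indicator (meets i a))) ⟩
    sum (λ i → count (meets i)) + count (not ∘ changed)
      ≡⟨ cong (_+ count (not ∘ changed)) (sum-cong-≗ old-degree) ⟩
    sum (λ i → degree (changed i)) + count (not ∘ changed)                  ≡⟨ total-degree changed ⟩
    sum {k} (λ _ → 2)                                                       ≡⟨ total-degree touches-changed ⟨
    sum (λ a → degree (touches-changed a)) + count (not ∘ touches-changed)  ≤⟨ ℕₚ.+-monoʳ-≤ _ untouched≤unchanged ⟩
    sum (λ a → degree (touches-changed a)) + count (not ∘ changed)          ∎)
    where
    open ℕₚ.≤-Reasoning
    total-degree : (c : Fin k → Bool) → sum (λ i → degree (c i)) + count (not ∘ c) ≡ sum {k} (λ _ → 2)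
    total-degree c =
      trans (sym (∑-distrib-+ (λ i → degree (c i)) (λ i → indicator (not (c i))))) (sum-cong-≗ (λ i → two (c i)))
      where
      two : ∀ b → degree b + indicator (not b) ≡ 2
      two true = refl
      two false = refl

  new-degree : ∀ a → degree (touches-changed a) ≡ count (λ i → meets i a)
  new-degree = sum-mono-≤-equality new-degree-≥ (ℕₚ.≤-antisym (sum-mono-≤ new-degree-≥) incidences≤)

  partner-unique : ∀ i j j′ a → changed i ≡ true → changed j ≡ true → changed j′ ≡ true →
    meets i a ≡ true → meets j a ≡ true → meets j′ a ≡ true → j ≢ i → j′ ≢ i → j ≡ j′
  partner-unique i j j′ a ch-i _ _ meets-i meets-j meets-j′ j≢i j′≢i with toSum (j ≟ j′)
  ... | inj₁ j≡j′ = j≡j′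
  ... | inj₂ j≢j′ = ⊥-elim (<-irrefl refl (begin-strict
    2                                <⟨ ℕₚ.n<1+n 2 ⟩
    3                                ≤⟨ count≥3 (λ i → meets i a) i j j′ (j≢i ∘ sym) (j′≢i ∘ sym) j≢j′ meets-i meets-j meets-j′ ⟩
    count (λ i → meets i a)          ≡⟨ new-degree a ⟨
    degree (touches-changed a)       ≡⟨ cong degree touched ⟩
    2                                ∎))
    where
    open ℕₚ.≤-Reasoning
    touched : touches-changed a ≡ true
    touched = ∃⇒anyFin (λ i → changed i ∧ meets i a) i (∧-intro ch-i meets-i)

  open TwoRegularBipartite changed meets first second first≢second meets⇒first∨second meets-first meets-second
    partner partner-unique using (Cycle; CycleCover; cycle-cover; other-new; other-new-spec)

  opaque
    cover : CycleCover changed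
    cover = cycle-cover k changed (count-≤ changed) (λ _ ch → ch) (λ _ _ _ _ ch _ _ → ch)

  open CycleCover cover using (r; cycles; disjoint; covers)

  Pos : Fin r → Set
  Pos a = Fin (2 + Cycle.len₋₂ (cycles a))

  old new : (a : Fin r) → Pos a → Fin k
  old a = Cycle.old (cycles a)
  new a = Cycle.new (cycles a)

  same-cycle : ∀ {a a′} {x : Pos a} {x′ : Pos a′} → old a x ≡ old a′ x′ → a ≡ a′
  same-cycle {a} {a′} {x} {x′} e with toSum (a ≟ a′)
  ... | inj₁ a≡a′ = a≡a′
  ... | inj₂ a≢a′ = ⊥-elim (disjoint a a′ x x′ a≢a′ e)

  old-changed : ∀ a x → changed (old a x) ≡ true
  old-changed a = Cycle.old-changed (cycles a)

  next-≢ : ∀ a x → old a (cnext x) ≢ old a x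
  next-≢ a x e = cnext-≢ x (Cycle.old-injective (cycles a) _ _ e)

  meets-old⇒new : ∀ a y b → meets (old a y) b ≡ true → ∃ λ x → new a x ≡ b
  meets-old⇒new a y b h with cnext-surjective y
  ... | x , refl with other-new-spec (old a (cnext x)) (new a (cnext x)) (old-changed a (cnext x)) (Cycle.meets-new (cycles a) (cnext x))
  ...   | _ , _ , only with only b h | only (new a x) (Cycle.next-meets-new (cycles a) x)
  ...     | inj₁ b≡ | _ = cnext x , sym b≡
  ...     | inj₂ _ | inj₁ e = ⊥-elim (Cycle.new-≢ (cycles a) x (sym e))
  ...     | inj₂ b≡ | inj₂ e = x , trans e (sym b≡)

  olds-of-new : ∀ a x v → L̃ v ≡ new a x → L v ≡ old a x ⊎ L v ≡ old a (cnext x)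
  olds-of-new a x v L̃v≡ with toSum (L v ≟ old a x)
  ... | inj₁ Lv≡ = inj₁ Lv≡
  ... | inj₂ Lv≢ = inj₂ (partner-unique (old a x) (L v) (old a (cnext x)) (new a x)
          (old-changed a x) (meets-changed (old a x) (L v) (new a x) (old-changed a x) meets-x meets-v) (old-changed a (cnext x))
          meets-x meets-v (Cycle.next-meets-new (cycles a) x) Lv≢ (next-≢ a x))
    where
    meets-x : meets (old a x) (new a x) ≡ true
    meets-x = Cycle.meets-new (cycles a) x
    meets-v : meets (L v) (new a x) ≡ true
    meets-v = meets⇐ v refl L̃v≡

  data NewPart (b : Fin k) : Set where
    on-cycle : ∀ a x → new a x ≡ b → NewPart b
    off-cycles : (∀ a x → new a x ≢ b) → NewPart b

  classify : ∀ b → NewPart b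
  classify b with search (λ a → anyFin (λ x → new a x == b))
  ... | inj₁ (a , h) = let x , e = anyFin⇒∃ (λ x → new a x == b) h in on-cycle a x (==⇒≡ e)
  ... | inj₂ none = off-cycles (λ a x e → true≢false (trans (sym (∃⇒anyFin (λ x → new a x == b) x (≡⇒== e))) (none a)))

  off-cycles⇒unchanged : ∀ {b} → (∀ a x → new a x ≢ b) → ∀ v → L̃ v ≡ b → changed (L v) ≡ false
  off-cycles⇒unchanged off v L̃v≡b = ¬-not λ ch → let a , y , e = covers (L v) ch ; x , e′ = meets-old⇒new a y _ (meets⇐ v (sym e) L̃v≡b)
                                                  in off a x e′

  -- Each new part is the image of a single old part: the next part of its cycle, or the unchanged old part equal to it.
  target : Fin k → Fin k
  target b with classify b
  ... | on-cycle a x _ = old a (cnext x)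
  ... | off-cycles _ = L (w₀ b)

  target-injective : ∀ b b′ → target b ≡ target b′ → b ≡ b′
  target-injective b b′ e with classify b | classify b′
  ... | on-cycle a x refl | on-cycle a′ x′ refl with same-cycle e
  ...   | refl = cong (new a) (cnext-injective x x′ (Cycle.old-injective (cycles a) _ _ e))
  target-injective b b′ e | on-cycle a x _ | off-cycles off′ =
    ⊥-elim (true≢false (trans (sym (old-changed a (cnext x))) (trans (cong changed e) (off-cycles⇒unchanged off′ (w₀ b′) (L̃-w₀ b′)))))
  target-injective b b′ e | off-cycles off | on-cycle a′ x′ _ =
    ⊥-elim (true≢false (trans (sym (old-changed a′ (cnext x′))) (trans (cong changed (sym e)) (off-cycles⇒unchanged off (w₀ b) (L̃-w₀ b)))))
  target-injective b b′ e | off-cycles off | off-cycles off′ = begin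
    b                    ≡⟨ L̃-w₀ b ⟨
    L̃ (w₀ b)             ≡⟨ unchanged-⊆ (L (w₀ b)) (off-cycles⇒unchanged off (w₀ b) (L̃-w₀ b)) (w₀ b) refl ⟩
    image (L (w₀ b))     ≡⟨ cong image e ⟩
    image (L (w₀ b′))    ≡⟨ unchanged-⊆ (L (w₀ b′)) (off-cycles⇒unchanged off′ (w₀ b′) (L̃-w₀ b′)) (w₀ b′) refl ⟨
    L̃ (w₀ b′)            ≡⟨ L̃-w₀ b′ ⟩
    b′                   ∎
    where open ≡-Reasoning

  moved : (a : Fin r) → Pos a → VSet (n G)
  moved a x v = (L v == old a x) ∧ (L̃ v == new a x)

  Q : V → Fin k
  Q v = target (L̃ v)

  Q∼L̃ : SamePartition Q L̃
  Q∼L̃ u v = mk⇔ (target-injective (L̃ u) (L̃ v)) (cong target)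

  Q-moved : ∀ v a x → L v ≡ old a x → moved a x v ≡ true → Q v ≡ old a (cnext x)
  Q-moved v a x Lv≡ h with classify (L̃ v)
  ... | off-cycles off = ⊥-elim (off a x (sym (==⇒≡ (∧-elimʳ {L v == old a x} h))))
  ... | on-cycle a′ x′ e with olds-of-new a′ x′ v (sym e)
  ...   | inj₁ Lv≡′ with same-cycle (trans (sym Lv≡) Lv≡′)
  ...     | refl with Cycle.old-injective (cycles a) _ _ (trans (sym Lv≡) Lv≡′)
  ...       | refl = refl
  Q-moved v a x Lv≡ h | on-cycle a′ x′ e | inj₂ Lv≡′ with same-cycle (trans (sym Lv≡) Lv≡′)
  ... | refl with Cycle.old-injective (cycles a) _ _ (trans (sym Lv≡) Lv≡′)
  ...   | refl = ⊥-elim (Cycle.new-≢ (cycles a) x′ (trans (sym (==⇒≡ (∧-elimʳ {L v == old a x} h))) (sym e)))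

  Q-stays : ∀ v → (∀ a x → ¬ ((L v ≡ old a x) × (moved a x v ≡ true))) → Q v ≡ L v
  Q-stays v stays with classify (L̃ v)
  ... | on-cycle a x e with olds-of-new a x v (sym e)
  ...   | inj₁ Lv≡ = ⊥-elim (stays a x (Lv≡ , ∧-intro (≡⇒== Lv≡) (≡⇒== (sym e))))
  ...   | inj₂ Lv≡ = sym Lv≡
  Q-stays v stays | off-cycles off = unchanged-⊇ (L v) unch (w₀ (L̃ v)) (trans (L̃-w₀ (L̃ v)) (unchanged-⊆ (L v) unch v refl))
    where
    unch : changed (L v) ≡ false
    unch = off-cycles⇒unchanged off v refl

  record Bridge (i i′ b : Fin k) : Set where
    field
      from to : V
      adjacent : adj G from to ≡ true
      L-from : L from ≡ i
      L̃-from : L̃ from ≡ b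
      L-to : L to ≡ i′
      L̃-to : L̃ to ≡ b

  -- Inside the connected new part b, a walk from old part i to old part i′ leaves i towards i′.
  bridge : ∀ i i′ b → changed i ≡ true → meets i b ≡ true → meets i′ b ≡ true → i′ ≢ i → Bridge i i′ b
  bridge i i′ b ch meets-i meets-i′ i′≢i with meets⇒ i b meets-i | meets⇒ i′ b meets-i′
  ... | h , Lh≡i , L̃h≡b | w , Lw≡i′ , L̃w≡b
    with walk-leaves (λ v → L v == i) (proj₂ (L̃-connected b) h w (≡⇒== L̃h≡b) (≡⇒== L̃w≡b)) (≡⇒== L̃h≡b)
                     (≡⇒== Lh≡i) (≢⇒==-false (i′≢i ∘ trans (sym Lw≡i′)))
  ... | u , u′ , Guu′ , u∈b , u′∈b , Lu≡i , Lu′≢i =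
    record { from = u ; to = u′ ; adjacent = Guu′ ; L-from = ==⇒≡ Lu≡i ; L̃-from = ==⇒≡ u∈b ; L-to = Lu′≡i′ ; L̃-to = ==⇒≡ u′∈b }
    where
    meets-u′ : meets (L u′) b ≡ true
    meets-u′ = meets⇐ u′ refl (==⇒≡ u′∈b)
    Lu′≡i′ : L u′ ≡ i′
    Lu′≡i′ = partner-unique i (L u′) i′ b ch (meets-changed i (L u′) b ch meets-i meets-u′) (meets-changed i i′ b ch meets-i meets-i′)
               meets-i meets-u′ meets-i′ (==-false⇒≢ Lu′≢i) i′≢i

  link : ∀ a x → Bridge (old a x) (old a (cnext x)) (new a x)
  link a x = bridge (old a x) (old a (cnext x)) (new a x) (old-changed a x) (Cycle.meets-new (cycles a) x)
                    (Cycle.next-meets-new (cycles a) x) (next-≢ a x)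

  quotient-cycle : Fin r → QCycle G L
  quotient-cycle a = record
    { len₋₂ = Cycle.len₋₂ (cycles a)
    ; cpart = old a
    ; cpart-inj = Cycle.old-injective (cycles a)
    ; eu = Bridge.from ∘ link a
    ; ev = Bridge.to ∘ link a
    ; e-adj = Bridge.adjacent ∘ link a
    ; e-from = Bridge.L-from ∘ link a
    ; e-to = Bridge.L-to ∘ link a
    ; e-dist = distinct-links
    }
    where
    open Bridge
    distinct-links : ∀ x x′ → x ≢ x′ →
      ¬ (((from (link a x) ≡ from (link a x′)) × (to (link a x) ≡ to (link a x′))) ⊎
         ((from (link a x) ≡ to (link a x′)) × (to (link a x) ≡ from (link a x′))))
    distinct-links x x′ x≢x′ (inj₁ (same-from , _)) =
      x≢x′ (Cycle.old-injective (cycles a) x x′ (trans (sym (L-from (link a x))) (trans (cong L same-from) (L-from (link a x′)))))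
    distinct-links x x′ x≢x′ (inj₂ (from≡to , _))
      with Cycle.old-injective (cycles a) x (cnext x′) (trans (sym (L-from (link a x))) (trans (cong L from≡to) (L-to (link a x′))))
    ... | refl = Cycle.new-≢ (cycles a) x′ (trans (sym (L̃-from (link a (cnext x′)))) (trans (cong L̃ from≡to) (L̃-to (link a x′))))

  other-piece : ∀ i b → changed i ≡ true → meets i b ≡ true →
    ∀ v → ((L v == i) ∧ (L̃ v == other-new i b)) ≡ ((L v == i) ∧ not ((L v == i) ∧ (L̃ v == b)))
  other-piece i b ch meets-b v with toSum (L v ≟ i)
  ... | inj₂ Lv≢i rewrite ≢⇒==-false Lv≢i = refl
  ... | inj₁ Lv≡i rewrite ≡⇒== Lv≡i with other-new-spec i b ch meets-b
  ...   | _ , other≢b , only with only (L̃ v) (meets⇐ v Lv≡i refl)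
  ...     | inj₁ L̃v≡b = trans (≢⇒==-false (λ e → other≢b (trans (sym e) L̃v≡b))) (cong not (sym (≡⇒== L̃v≡b)))
  ...     | inj₂ L̃v≡other = trans (≡⇒== L̃v≡other) (cong not (sym (≢⇒==-false (λ e → other≢b (trans (sym L̃v≡other) e)))))

  bud : (a : Fin r) → BUDChoice G L (quotient-cycle a)
  bud a = record
    { H = moved a
    ; H-sub = λ x v h → ==⇒≡ (∧-elimˡ h)
    ; H-conn = λ x → piece-connected (old a x) (new a x) (old-changed a x) (Cycle.meets-new (cycles a) x)
    ; R-conn = λ x → InducesConnected-cong G (other-piece (old a x) (new a x) (old-changed a x) (Cycle.meets-new (cycles a) x))
                       (piece-connected (old a x) (other-new (old a x) (new a x)) (old-changed a x)
                         (proj₁ (other-new-spec (old a x) (new a x) (old-changed a x) (Cycle.meets-new (cycles a) x))))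
    }

  differ : DifferByDisjointBUD G L L̃
  differ = r , quotient-cycle , bud , (λ a b x y a≢b → disjoint a b x y a≢b) ,
           Q , (λ v → Q-moved v , Q-stays v) , Q∼L̃

corollary3p6 : (G : Graph) → ConnectedGraph G →
    (p : Fin (n G) → ℚ) → (∀ v → 0ℚ <ℚ p v) →
    (k : ℕ) → 2 ≤ k →
    (P P̃ : BalancedPartition G p k) →
    ¬ SamePartition (label P) (label P̃) →
    (T : Fin k → ESet (n G)) → (∀ i → IsUniqueSpanningTree G (part (label P) i) (T i)) →
    (T̃ : Fin k → ESet (n G)) → (∀ i → IsUniqueSpanningTree G (part (label P̃) i) (T̃ i)) →
    DifferByDisjointBUD G (label P) (label P̃)
      ⇔ (partsNotIn (label P) (label P̃) ≡ edgesNotIn G T T̃)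
corollary3p6 G _ p positive k _ P P̃ _ T T-unique T̃ T̃-unique = mk⇔ from-bud to-bud
  where
  open Comparison G (label P) (label P̃) T-unique T̃-unique using (module FromBUD)
  from-bud : DifferByDisjointBUD G (label P) (label P̃) → partsNotIn (label P) (label P̃) ≡ edgesNotIn G T T̃
  from-bud (r , C , B , disjoint , Q , Q-spec , Q∼L̃) =
    FromBUD.counts-agree (λ i → Data.Product.map₂ ==⇒≡ (proj₁ (connected P i))) r C B disjoint Q Q-spec Q∼L̃
  to-bud : partsNotIn (label P) (label P̃) ≡ edgesNotIn G T T̃ → DifferByDisjointBUD G (label P) (label P̃)
  to-bud = ToBUD.differ G (label P) (label P̃) T-unique T̃-unique (connected P) (connected P̃) p positive (balanced P) (balanced P̃)
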